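{- Let $\mathcal{M}=(X,rk,m)$ be a multiplicity matroid whose underlying matroid $M=(X,rk)$ is loopless, and write $\mathfrak{M}_{\mathcal{M}}(x,y)=\sum_{i,j\ge0}b_{i,j}x^iy^j$. Then (1) $b_{rk(M),0}=m(\emptyset)$; (2) $b_{rk(M)-1,0}=(p(M)-rk(M))m(\emptyset)+\sum_{F\in\mathcal{F}_1(M)}\sum_{A\subseteq F}(-1)^{|A|+1}m(A)$; (3) \[b_{rk(M)-2,0}=\Big(\tbinom{rk(M)}{2}-(rk(M)-1)p(M)+\sum_{F\in\mathcal{F}_2(M)}(p(F)-1)\Big)m(\emptyset)+\sum_{F\in\mathcal{F}_1(M)}(p(M/F)-rk(M)+1)\sum_{A\subseteq F}(-1)^{|A|+1}m(A)+\sum_{F\in\mathcal{F}_2(M)}\sum_{A\subseteq F}(-1)^{|A|}m(A);\] (4) $b_{rk(M)-1,1}=\sum_{F\in\mathcal{F}'_1(M)}\sum_{A\subseteq F,|A|\ge2}(-1)^{|A|}(|A|-1)m(A)$; (5) \[b_{rk(M)-2,1}=\sum_{F\in\mathcal{F}'_1(M)}(p(M/F)-rk(M)+1)\sum_{A\subseteq F,|A|\ge2}(-1)^{|A|}(|A|-1)m(A)+\sum_{F\in\mathcal{F}_2(M)}\sum_{A\subseteq F,|A|\ge2}(-1)^{|A|+1}(|A|-rk(A))m(A);\] (6) \[b_{rk(M)-2,2}=\sum_{F\in\mathcal{F}'_1(M)}(p(M/F)-rk(M)+1)\sum_{A\subseteq F,|A|\ge3}(-1)^{|A|+1}\tbinom{|A|-1}{2}m(A)+\sum_{F\in\mathcal{F}_2(M)}\sum_{A\subseteq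 F,|A|\ge3}(-1)^{|A|}\tbinom{|A|-rk(A)}{2}m(A).\]
   Context: A matroid $(X,rk)$ is a finite set with rank function $rk:2^X\to\mathbb{Z}_{\ge0}$ satisfying $rk(A)\le|A|$, monotonicity and submodularity; $rk(M)=rk(X)$; loopless means no $e$ with $rk(\{e\})=0$. A multiplicity matroid $\mathcal{M}=(X,rk,m)$ is a matroid with an arbitrary function $m:2^X\to\mathbb{Z}_{>0}$; its multiplicity Tutte polynomial is $\mathfrak{M}_{\mathcal{M}}(x,y)=\sum_{A\subseteq X}m(A)(x-1)^{rk(X)-rk(A)}(y-1)^{|A|-rk(A)}$. A flat is a set $F$ with $\{e:rk(F\cup\{e\})=rk(F)\}=F$; a circuit is a set $C$ with $rk(C\setminus\{e\})=|C|-1=rk(C)$ for all $e\in C$; a flat $F$ is cyclic if every $e\in F$ lies in a circuit contained in $F$. $\mathcal{F}_i(M)$ is the set of flats of rank $i$ and $\mathcal{F}'_i(M)$ the set of cyclic flats of rank $i$. Elements $e,f$ are parallel if $rk(\{e,f\})=rk(\{e\})=rk(\{f\})=1$; a parallel class is a maximal set of non-loop elements pairwise parallel. $p(N)$ is the number of parallel classes of a matroid $N$; $p(F)$ means $p(M|F)$ for the restriction $M|F$ (rank function restricted to subsets of $F$). The contraction $M/F$ is the matroid on $X\setminus F$ with $rk_{M/F}(A)=rk(A\cup F)-rk(F)$. -}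

module Defs where

open import Data.Nat as ℕ using (ℕ; zero; suc; _≤_; _<_; _∸_)
open import Data.Integer as ℤ using (ℤ; +_; -[1+_]; 0ℤ; 1ℤ; -1ℤ)
open import Data.Fin using (Fin)
open import Data.Fin.Subset
open import Data.Fin.Subset.Properties using (_∈?_; _⊆?_; nonempty?; anySubset?)
open import Data.Fin.Properties using (all?; any?)
open import Data.List using (List; []; _∷_; _++_; map; filter; length)
open import Data.Vec using (_∷_; [])
open import Data.Bool using (true; false)
open import Data.Product using (_×_; _,_; ∃)
open import Relation.Binary.PropositionalEquality using (_≡_)
open import Relation.Nullary using (¬_; Dec; yes; no; ¬?)
open import Relation.Nullary.Decidable using (_×-dec_; _→-dec_)

record Matroid (n : ℕ) : Set where
  field
    rk      : Subset n → ℕ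
    rk-card : ∀ A → rk A ≤ ∣ A ∣
    rk-mono : ∀ A B → A ⊆ B → rk A ≤ rk B
    rk-sub  : ∀ A B → rk (A ∪ B) ℕ.+ rk (A ∩ B) ≤ rk A ℕ.+ rk B

record MultMatroid (n : ℕ) : Set where
  field
    matroid : Matroid n
    m       : Subset n → ℕ
    m-pos   : ∀ A → 0 < m A
  open Matroid matroid public

Loopless : ∀ {n} → Matroid n → Set
Loopless {n} M = (e : Fin n) → ¬ (Matroid.rk M ⁅ e ⁆ ≡ 0)

allSubsets : (n : ℕ) → List (Subset n)
allSubsets zero    = [] ∷ []
allSubsets (suc n) = map (inside ∷_) (allSubsets n) ++ map (outside ∷_) (allSubsets n)

module _ {n : ℕ} (r : Subset n → ℕ) where

  -- F is a flat: {e : r(F ∪ e) = r F} = F (the inclusion ⊇ is automatic)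
  IsFlat : Subset n → Set
  IsFlat F = (e : Fin n) → r (F ∪ ⁅ e ⁆) ≡ r F → e ∈ F

  isFlat? : (F : Subset n) → Dec (IsFlat F)
  isFlat? F = all? (λ e → (r (F ∪ ⁅ e ⁆) ℕ.≟ r F) →-dec (e ∈? F))

  -- C is a circuit: r(C ∖ e) = |C| - 1 = r(C) for all e ∈ C
  -- (written with + 1 to avoid truncated subtraction)
  IsCircuit : Subset n → Set
  IsCircuit C = (r C ℕ.+ 1 ≡ ∣ C ∣) × ((e : Fin n) → e ∈ C → r (C - e) ℕ.+ 1 ≡ ∣ C ∣)

  isCircuit? : (C : Subset n) → Dec (IsCircuit C)
  isCircuit? C = (r C ℕ.+ 1 ℕ.≟ ∣ C ∣)
    ×-dec all? (λ e → (e ∈? C) →-dec (r (C - e) ℕ.+ 1 ℕ.≟ ∣ C ∣))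

  IsCyclicFlat : Subset n → Set
  IsCyclicFlat F = IsFlat F ×
    ((e : Fin n) → e ∈ F → ∃ λ C → (C ⊆ F × IsCircuit C) × e ∈ C)

  isCyclicFlat? : (F : Subset n) → Dec (IsCyclicFlat F)
  isCyclicFlat? F = isFlat? F ×-dec
    all? (λ e → (e ∈? F) →-dec anySubset? (λ C → ((C ⊆? F) ×-dec isCircuit? C) ×-dec (e ∈? C)))

  NonLoop : Fin n → Set
  NonLoop e = ¬ (r ⁅ e ⁆ ≡ 0)

  Parallel : Fin n → Fin n → Set
  Parallel e f = (r (⁅ e ⁆ ∪ ⁅ f ⁆) ≡ 1) × (r ⁅ e ⁆ ≡ 1) × (r ⁅ f ⁆ ≡ 1)

  parallel? : ∀ e f → Dec (Parallel e f)
  parallel? e f = (r (⁅ e ⁆ ∪ ⁅ f ⁆) ℕ.≟ 1) ×-dec ((r ⁅ e ⁆ ℕ.≟ 1) ×-dec (r ⁅ f ⁆ ℕ.≟ 1))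

  -- parallel class of the matroid with ground set G ⊆ Fin n and rank r:
  -- a (nonempty) maximal set of non-loop elements of G, pairwise parallel
  IsParallelClass : Subset n → Subset n → Set
  IsParallelClass G P = P ⊆ G × Nonempty P
    × ((e : Fin n) → e ∈ P → NonLoop e)
    × ((e f : Fin n) → e ∈ P → f ∈ P → Parallel e f)
    × ((e : Fin n) → e ∈ G → ¬ (e ∈ P) → ¬ (NonLoop e × ((f : Fin n) → f ∈ P → Parallel e f)))

  isParallelClass? : (G P : Subset n) → Dec (IsParallelClass G P)
  isParallelClass? G P = (P ⊆? G) ×-dec (nonempty? P
    ×-dec (all? (λ e → (e ∈? P) →-dec ¬? (r ⁅ e ⁆ ℕ.≟ 0))
    ×-dec (all? (λ e → all? (λ f → (e ∈? P) →-dec ((f ∈? P) →-dec parallel? e f))))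
    ×-dec all? (λ e → (e ∈? G) →-dec (¬? (e ∈? P) →-dec
             ¬? (¬? (r ⁅ e ⁆ ℕ.≟ 0) ×-dec all? (λ f → (f ∈? P) →-dec parallel? e f))))))

  numParallel : Subset n → ℕ
  numParallel G = length (filter (isParallelClass? G) (allSubsets n))

module _ {n : ℕ} (M : Matroid n) where
  open Matroid M

  rkM : ℕ
  rkM = rk ⊤

  flats : ℕ → List (Subset n)
  flats i = filter (λ F → isFlat? rk F ×-dec (rk F ℕ.≟ i)) (allSubsets n)

  cyclicFlats : ℕ → List (Subset n)
  cyclicFlats i = filter (λ F → isCyclicFlat? rk F ×-dec (rk F ℕ.≟ i)) (allSubsets n)

  pM : ℕ
  pM = numParallel rk ⊤

  pRestr : Subset n → ℕ
  pRestr F = numParallel rk F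

  rkContr : Subset n → Subset n → ℕ
  rkContr F A = rk (A ∪ F) ∸ rk F

  pContr : Subset n → ℕ
  pContr F = numParallel (rkContr F) (∁ F)

subsetsOf : ∀ {n} → Subset n → List (Subset n)
subsetsOf {n} F = filter (_⊆? F) (allSubsets n)

subsetsOf≥ : ∀ {n} → ℕ → Subset n → List (Subset n)
subsetsOf≥ {n} k F = filter (λ A → (A ⊆? F) ×-dec (k ℕ.≤? ∣ A ∣)) (allSubsets n)

Σ[_]_ : ∀ {n} → List (Subset n) → (Subset n → ℤ) → ℤ
Σ[ [] ] f = 0ℤ
Σ[ A ∷ As ] f = f A ℤ.+ Σ[ As ] f

-- Bivariate integer polynomials as coefficient functions: p i j = coeff of x^i y^j

Poly : Set
Poly = ℕ → ℕ → ℤ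

sumTo : ℕ → (ℕ → ℤ) → ℤ
sumTo zero    f = f 0
sumTo (suc k) f = sumTo k f ℤ.+ f (suc k)

_+ₚ_ : Poly → Poly → Poly
(p +ₚ q) i j = p i j ℤ.+ q i j

_*ₚ_ : Poly → Poly → Poly
(p *ₚ q) i j = sumTo i (λ k → sumTo j (λ l → p k l ℤ.* q (i ∸ k) (j ∸ l)))

constₚ : ℤ → Poly
constₚ c zero    zero    = c
constₚ c zero    (suc _) = 0ℤ
constₚ c (suc _) _       = 0ℤ

xₚ : Poly
xₚ (suc zero) zero = 1ℤ
xₚ _          _    = 0ℤ

yₚ : Poly
yₚ zero (suc zero) = 1ℤ
yₚ _    _          = 0ℤ

_^ₚ_ : Poly → ℕ → Poly
p ^ₚ zero  = constₚ 1ℤ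
p ^ₚ suc k = p *ₚ (p ^ₚ k)

Σₚ : ∀ {n} → List (Subset n) → (Subset n → Poly) → Poly
Σₚ []       f = constₚ 0ℤ
Σₚ (A ∷ As) f = f A +ₚ Σₚ As f

multTutte : ∀ {n} → MultMatroid n → Poly
multTutte {n} MM = Σₚ (allSubsets n) λ A →
  constₚ (+ m A) *ₚ (((xₚ +ₚ constₚ -1ℤ) ^ₚ (rk ⊤ ∸ rk A))
                 *ₚ ((yₚ +ₚ constₚ -1ℤ) ^ₚ (∣ A ∣ ∸ rk A)))
  where open MultMatroid MM

-- coefficient b_{i,j} of x^i y^j, with i ∈ ℤ (zero for negative i)
coeff : Poly → ℤ → ℕ → ℤ
coeff p (+ i)    j = p i j
coeff p -[1+ _ ] j = 0ℤ

-- Expanding (x − 1)^(r − rk A) (y − 1)^(∣A∣ − rk A) gives b_{r−d,j} = Σ_A m(A) c(r − rk A, r − d) c(∣A∣ − rk A, j),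
-- where c(u, v) = (−1)^(u+v) binom(u, v) is the coefficient of x^v in (x − 1)^u and vanishes for v < 0; so only
-- sets of rank at most d contribute. On the right-hand sides, exchanging the sums over flats F and over A ⊆ F
-- weights each A by the (cyclic) flats of rank 1 or 2 containing it. A set of rank k lies in exactly one flat of
-- rank k, its closure, and in none of smaller rank; a rank-1 set with at least two elements spans a cyclic flat;
-- and the rank-2 flats containing a rank-1 flat F are the sets P ∪ F for the parallel classes P of M/F. As M is
-- loopless, the parallel classes of M|G are the rank-1 flats inside G, so p(M) = |F₁| and, by double counting,
-- Σ_{F ∈ F₁} p(M/F) = Σ_{G ∈ F₂} p(G). With these counts both sides agree set by set, according as A = ∅ or
-- rk A = 1, 2 or at least 3.

module Submission where

open import Defs
open import Data.Nat using (ℕ; _∸_)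
open import Data.Nat.Combinatorics using (_C_)
open import Data.Integer using (ℤ; +_; _+_; _-_; _*_; -1ℤ; _^_)
open import Data.Fin.Subset using (Subset; ⊥; ∣_∣)
open import Data.Product using (_×_)
open import Relation.Binary.PropositionalEquality using (_≡_)

open import Data.Bool using (true; false)
open import Data.Bool.Properties using () renaming (_≟_ to _≟ᵇ_)
open import Data.Empty using (⊥-elim)
open import Data.Fin using (Fin) renaming (_≟_ to _≟ᶠ_)
open import Data.Fin.Properties using (any?)
open import Data.Fin.Subset using (inside; outside; ⊤; ⁅_⁆; _∪_; _∩_; ∁; _∈_; _∉_; _⊆_; Nonempty)
  renaming (_-_ to _∖_)
open import Data.Fin.Subset.Properties
  using (_∈?_; _⊆?_; nonempty?; ⊥⊆; ⊆⊤; ∈⊤; ⊆-antisym; ∣⊥∣≡0; ∣p∣≤n; ∣⁅x⁆∣≡1; p⊆q⇒∣p∣≤∣q∣; x∈⁅x⁆; x∈⁅y⁆⇒x≡y;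
         x∈p∪q⁻; p⊆p∪q; q⊆p∪q; ∪-identityˡ; ∪-identityʳ; x∈p∩q⁺; p∩q⊆p; p∩q⊆q; x∈∁p⇒x∉p; x∉p⇒x∈∁p;
         p─q⊆p; x∈p∧x≢y⇒x∈p-y; x∈p⇒∣p-x∣<∣p∣)
open import Data.Integer using (0ℤ; 1ℤ; -_; -[1+_])
open import Data.Integer.Tactic.RingSolver using (solve-∀; solve)
open import Data.List using (List; []; _∷_; _++_; map; filter; length)
open import Data.Nat as ℕ using (zero; suc; _≤_; _<_; z≤n; s≤s)
open import Data.Nat.Combinatorics using (nCn≡1; nC1≡n; nCk≡nC[n∸k]; k>n⇒nCk≡0; nCk+nC[k+1]≡[n+1]C[k+1])
open import Data.Product using (_,_; proj₁; proj₂; ∃)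
open import Data.Sum using (inj₁; inj₂; [_,_]′)
open import Data.Vec as Vec using (tabulate)
open import Data.Vec.Properties using (∷-injectiveˡ; ∷-injectiveʳ; ≡-dec; lookup∘tabulate; []=⇒lookup; lookup⇒[]=)
open import Relation.Binary.PropositionalEquality using (refl; sym; trans; cong; cong₂; subst; subst₂; module ≡-Reasoning)
open import Relation.Nullary using (Dec; yes; no; ¬_; ¬?; does)
open import Relation.Nullary.Decidable using (_×-dec_)
import Data.Integer.Properties as ℤ
import Data.Nat.Properties as ℕ

𝟙 : ∀ {p} {P : Set p} → Dec P → ℤ
𝟙 (yes _) = 1ℤ
𝟙 (no _)  = 0ℤ

𝟙-yes : ∀ {p} {P : Set p} (P? : Dec P) → P → 𝟙 P? ≡ 1ℤ
𝟙-yes (yes _) _ = refl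
𝟙-yes (no ¬p) p = ⊥-elim (¬p p)

𝟙-no : ∀ {p} {P : Set p} (P? : Dec P) → ¬ P → 𝟙 P? ≡ 0ℤ
𝟙-no (yes p) ¬p = ⊥-elim (¬p p)
𝟙-no (no _)  _  = refl

𝟙-× : ∀ {p q} {P : Set p} {Q : Set q} (P? : Dec P) (Q? : Dec Q) → 𝟙 (P? ×-dec Q?) ≡ 𝟙 P? * 𝟙 Q?
𝟙-× (yes _) (yes _) = refl
𝟙-× (yes _) (no _)  = refl
𝟙-× (no _)  (yes _) = refl
𝟙-× (no _)  (no _)  = refl

𝟙-⇔ : ∀ {p q} {P : Set p} {Q : Set q} (P? : Dec P) (Q? : Dec Q) → (P → Q) → (Q → P) → 𝟙 P? ≡ 𝟙 Q?
𝟙-⇔ (yes _) (yes _) _ _ = refl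
𝟙-⇔ (yes p) (no ¬q) f _ = ⊥-elim (¬q (f p))
𝟙-⇔ (no ¬p) (yes q) _ g = ⊥-elim (¬p (g q))
𝟙-⇔ (no _)  (no _)  _ _ = refl

𝟙-*-cong : ∀ {p} {P : Set p} (P? : Dec P) {x y : ℤ} → (P → x ≡ y) → 𝟙 P? * x ≡ 𝟙 P? * y
𝟙-*-cong (yes p) x≡y = cong (1ℤ *_) (x≡y p)
𝟙-*-cong (no _)  _   = refl

_≟ˢ_ : ∀ {n} (A B : Subset n) → Dec (A ≡ B)
_≟ˢ_ = ≡-dec _≟ᵇ_

module _ {n : ℕ} where

  Σ-cong : (xs : List (Subset n)) {f g : Subset n → ℤ} → (∀ A → f A ≡ g A) → Σ[ xs ] f ≡ Σ[ xs ] g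
  Σ-cong []       f≡g = refl
  Σ-cong (x ∷ xs) f≡g = cong₂ _+_ (f≡g x) (Σ-cong xs f≡g)

  Σ-≡0 : (xs : List (Subset n)) (f : Subset n → ℤ) → (∀ A → f A ≡ 0ℤ) → Σ[ xs ] f ≡ 0ℤ
  Σ-≡0 []       f f≡0 = refl
  Σ-≡0 (x ∷ xs) f f≡0 = cong₂ _+_ (f≡0 x) (Σ-≡0 xs f f≡0)

  Σ-+ : (xs : List (Subset n)) (f g : Subset n → ℤ) → Σ[ xs ] (λ A → f A + g A) ≡ Σ[ xs ] f + Σ[ xs ] g
  Σ-+ []       f g = refl
  Σ-+ (x ∷ xs) f g = trans (cong (_+_ (f x + g x)) (Σ-+ xs f g)) (interchange (f x) (g x) _ _)
    where
    interchange : ∀ a b c d → a + b + (c + d) ≡ a + c + (b + d)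
    interchange = solve-∀

  Σ-*ˡ : (xs : List (Subset n)) (c : ℤ) (f : Subset n → ℤ) → Σ[ xs ] (λ A → c * f A) ≡ c * Σ[ xs ] f
  Σ-*ˡ []       c f = sym (ℤ.*-zeroʳ c)
  Σ-*ˡ (x ∷ xs) c f = trans (cong (_+_ (c * f x)) (Σ-*ˡ xs c f)) (sym (ℤ.*-distribˡ-+ c (f x) _))

  Σ-++ : (xs ys : List (Subset n)) (f : Subset n → ℤ) → Σ[ xs ++ ys ] f ≡ Σ[ xs ] f + Σ[ ys ] f
  Σ-++ []       ys f = sym (ℤ.+-identityˡ _)
  Σ-++ (x ∷ xs) ys f = trans (cong (_+_ (f x)) (Σ-++ xs ys f)) (sym (ℤ.+-assoc (f x) _ _))

  Σ-swap : (xs ys : List (Subset n)) (f : Subset n → Subset n → ℤ) →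
    Σ[ xs ] (λ A → Σ[ ys ] (f A)) ≡ Σ[ ys ] (λ B → Σ[ xs ] (λ A → f A B))
  Σ-swap []       ys f = sym (Σ-≡0 ys _ (λ _ → refl))
  Σ-swap (x ∷ xs) ys f = trans (cong (_+_ (Σ[ ys ] (f x))) (Σ-swap xs ys f)) (sym (Σ-+ ys (f x) _))

  Σ-filter : {P : Subset n → Set} (P? : ∀ A → Dec (P A)) (xs : List (Subset n)) (f : Subset n → ℤ) →
    Σ[ filter P? xs ] f ≡ Σ[ xs ] (λ A → 𝟙 (P? A) * f A)
  Σ-filter P? []       f = refl
  Σ-filter P? (x ∷ xs) f with P? x
  ... | yes _ = cong₂ _+_ (sym (ℤ.*-identityˡ (f x))) (Σ-filter P? xs f)
  ... | no _  = trans (Σ-filter P? xs f) (sym (ℤ.+-identityˡ _))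

  length-filter : {P : Subset n → Set} (P? : ∀ A → Dec (P A)) (xs : List (Subset n)) →
    + length (filter P? xs) ≡ Σ[ xs ] (λ A → 𝟙 (P? A))
  length-filter P? []       = refl
  length-filter P? (x ∷ xs) with P? x
  ... | yes _ = cong (_+_ 1ℤ) (length-filter P? xs)
  ... | no _  = trans (length-filter P? xs) (sym (ℤ.+-identityˡ _))

Σ-map : ∀ {m n} (h : Subset m → Subset n) (xs : List (Subset m)) (f : Subset n → ℤ) →
  Σ[ map h xs ] f ≡ Σ[ xs ] (λ A → f (h A))
Σ-map h []       f = refl
Σ-map h (x ∷ xs) f = cong (_+_ (f (h x))) (Σ-map h xs f)

Σ-allSubsets-single : ∀ n (A₀ : Subset n) (g : Subset n → ℤ) → (∀ A → ¬ A ≡ A₀ → g A ≡ 0ℤ) →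
  Σ[ allSubsets n ] g ≡ g A₀
Σ-allSubsets-single zero    Vec.[]       g _    = ℤ.+-identityʳ _
Σ-allSubsets-single (suc n) (x Vec.∷ A₀) g g≡0 = begin
  Σ[ map (inside ∷_) S ++ map (outside ∷_) S ] g
    ≡⟨ Σ-++ (map (inside ∷_) S) _ g ⟩
  Σ[ map (inside ∷_) S ] g + Σ[ map (outside ∷_) S ] g
    ≡⟨ cong₂ _+_ (Σ-map (inside ∷_) S g) (Σ-map (outside ∷_) S g) ⟩
  Σ[ S ] (λ A → g (inside ∷ A)) + Σ[ S ] (λ A → g (outside ∷ A))
    ≡⟨ split x g≡0 ⟩
  g (x ∷ A₀) ∎
  where
  open ≡-Reasoning
  -- Vec's _∷_ is opened only here: where it clashes with List's, the list arguments of solve elaborate very slowly.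
  open Vec using (_∷_)
  S : List (Subset n)
  S = allSubsets n
  on : ∀ b → (∀ A → ¬ A ≡ b ∷ A₀ → g A ≡ 0ℤ) → Σ[ S ] (λ A → g (b ∷ A)) ≡ g (b ∷ A₀)
  on b g≡0 = Σ-allSubsets-single n A₀ (λ A → g (b ∷ A)) (λ A A≢A₀ → g≡0 _ (λ eq → A≢A₀ (∷-injectiveʳ eq)))
  off : ∀ b c → ¬ b ≡ c → (∀ A → ¬ A ≡ c ∷ A₀ → g A ≡ 0ℤ) → Σ[ S ] (λ A → g (b ∷ A)) ≡ 0ℤ
  off b c b≢c g≡0 = Σ-≡0 S _ (λ A → g≡0 _ (λ eq → b≢c (∷-injectiveˡ eq)))
  split : ∀ x → (∀ A → ¬ A ≡ x ∷ A₀ → g A ≡ 0ℤ) →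
    Σ[ S ] (λ A → g (inside ∷ A)) + Σ[ S ] (λ A → g (outside ∷ A)) ≡ g (x ∷ A₀)
  split true  g≡0 = trans (cong₂ _+_ (on true g≡0) (off false true (λ ()) g≡0)) (ℤ.+-identityʳ _)
  split false g≡0 = trans (cong₂ _+_ (off true false (λ ()) g≡0) (on false g≡0)) (ℤ.+-identityˡ _)

Σ-𝟙-unique : ∀ {n} {P : Subset n → Set} (P? : ∀ A → Dec (P A)) (A₀ : Subset n) (w : Subset n → ℤ) →
  (∀ A → P A → A ≡ A₀) → P A₀ → Σ[ allSubsets n ] (λ A → 𝟙 (P? A) * w A) ≡ w A₀
Σ-𝟙-unique {n} P? A₀ w unique pA₀ = begin
  Σ[ allSubsets n ] (λ A → 𝟙 (P? A) * w A) ≡⟨ Σ-allSubsets-single n A₀ _ elsewhere ⟩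
  𝟙 (P? A₀) * w A₀                         ≡⟨ cong (_* w A₀) (𝟙-yes (P? A₀) pA₀) ⟩
  1ℤ * w A₀                                ≡⟨ ℤ.*-identityˡ _ ⟩
  w A₀                                     ∎
  where
  open ≡-Reasoning
  elsewhere : ∀ A → ¬ A ≡ A₀ → 𝟙 (P? A) * w A ≡ 0ℤ
  elsewhere A A≢A₀ = cong (_* w A) (𝟙-no (P? A) (λ pA → A≢A₀ (unique A pA)))

Σ-𝟙-bijection : ∀ {n} {P Q : Subset n → Set} (P? : ∀ A → Dec (P A)) (Q? : ∀ A → Dec (Q A))
  (f g : Subset n → Subset n) → (∀ A → P A → Q (f A)) → (∀ B → Q B → P (g B)) →
  (∀ A → P A → g (f A) ≡ A) → (∀ B → Q B → f (g B) ≡ B) →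
  Σ[ allSubsets n ] (λ A → 𝟙 (P? A)) ≡ Σ[ allSubsets n ] (λ B → 𝟙 (Q? B))
Σ-𝟙-bijection {n} {P} {Q} P? Q? f g PQ QP gf fg = begin
  Σ[ S ] (λ A → 𝟙 (P? A))
    ≡⟨ Σ-cong S (λ A → sym (Σ-𝟙-unique (λ B → B ≟ˢ f A) (f A) (λ _ → 𝟙 (P? A)) (λ _ eq → eq) refl)) ⟩
  Σ[ S ] (λ A → Σ[ S ] (λ B → 𝟙 (B ≟ˢ f A) * 𝟙 (P? A)))
    ≡⟨ Σ-swap S S _ ⟩
  Σ[ S ] (λ B → Σ[ S ] (λ A → 𝟙 (B ≟ˢ f A) * 𝟙 (P? A)))
    ≡⟨ Σ-cong S (λ B → trans (Σ-cong S (λ A → fibre B A)) (preimage B (Q? B))) ⟩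
  Σ[ S ] (λ B → 𝟙 (Q? B)) ∎
  where
  open ≡-Reasoning
  S : List (Subset n)
  S = allSubsets n
  fibre : ∀ B A → 𝟙 (B ≟ˢ f A) * 𝟙 (P? A) ≡ 𝟙 (P? A ×-dec (B ≟ˢ f A)) * 1ℤ
  fibre B A = trans (ℤ.*-comm (𝟙 (B ≟ˢ f A)) _)
    (trans (sym (𝟙-× (P? A) (B ≟ˢ f A))) (sym (ℤ.*-identityʳ _)))
  preimage : ∀ B → (Q? : Dec (Q B)) → Σ[ S ] (λ A → 𝟙 (P? A ×-dec (B ≟ˢ f A)) * 1ℤ) ≡ 𝟙 Q?
  preimage B (yes qB) = Σ-𝟙-unique (λ A → P? A ×-dec (B ≟ˢ f A)) (g B) (λ _ → 1ℤ)
    (λ A (pA , B≡fA) → trans (sym (gf A pA)) (cong g (sym B≡fA))) (QP B qB , sym (fg B qB))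
  preimage B (no ¬qB) = Σ-≡0 S _ (λ A → cong (_* 1ℤ) (𝟙-no (P? A ×-dec (B ≟ˢ f A))
    (λ (pA , B≡fA) → ¬qB (subst Q (sym B≡fA) (PQ A pA)))))

sumTo-cong : ∀ i {f g : ℕ → ℤ} → (∀ k → f k ≡ g k) → sumTo i f ≡ sumTo i g
sumTo-cong zero    f≡g = f≡g 0
sumTo-cong (suc i) f≡g = cong₂ _+_ (sumTo-cong i f≡g) (f≡g (suc i))

sumTo-≡0 : ∀ i (f : ℕ → ℤ) → (∀ k → k ≤ i → f k ≡ 0ℤ) → sumTo i f ≡ 0ℤ
sumTo-≡0 zero    f f≡0 = f≡0 0 z≤n
sumTo-≡0 (suc i) f f≡0 = cong₂ _+_ (sumTo-≡0 i f (λ k k≤i → f≡0 k (ℕ.m≤n⇒m≤1+n k≤i))) (f≡0 (suc i) ℕ.≤-refl)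

sumTo-head : ∀ i (f : ℕ → ℤ) → (∀ k → f (suc k) ≡ 0ℤ) → sumTo i f ≡ f 0
sumTo-head zero    f f≡0 = refl
sumTo-head (suc i) f f≡0 = trans (cong₂ _+_ (sumTo-head i f f≡0) (f≡0 i)) (ℤ.+-identityʳ _)

sumTo-head₂ : ∀ i (f : ℕ → ℤ) → (∀ k → f (suc (suc k)) ≡ 0ℤ) → sumTo (suc i) f ≡ f 0 + f 1
sumTo-head₂ zero    f f≡0 = refl
sumTo-head₂ (suc i) f f≡0 = trans (cong₂ _+_ (sumTo-head₂ i f f≡0) (f≡0 i)) (ℤ.+-identityʳ _)

sumTo-last : ∀ i (f : ℕ → ℤ) → (∀ k → k < i → f k ≡ 0ℤ) → sumTo i f ≡ f i
sumTo-last zero    f f≡0 = refl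
sumTo-last (suc i) f f≡0 = trans (cong (_+ f (suc i)) (sumTo-≡0 i f (λ k k≤i → f≡0 k (s≤s k≤i)))) (ℤ.+-identityˡ _)

constₚ0 : ∀ i j → constₚ 0ℤ i j ≡ 0ℤ
constₚ0 zero    zero    = refl
constₚ0 zero    (suc j) = refl
constₚ0 (suc i) j       = refl

Σₚ-coeff : ∀ {n} (As : List (Subset n)) (f : Subset n → Poly) i j → Σₚ As f i j ≡ Σ[ As ] (λ A → f A i j)
Σₚ-coeff []       f i j = constₚ0 i j
Σₚ-coeff (A ∷ As) f i j = cong (_+_ (f A i j)) (Σₚ-coeff As f i j)

constₚ-*ₚ : ∀ c p i j → (constₚ c *ₚ p) i j ≡ c * p i j
constₚ-*ₚ c p i j =
  trans (sumTo-head i _ (λ k → sumTo-≡0 j _ (λ l _ → ℤ.*-zeroˡ (p (i ∸ suc k) (j ∸ l)))))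
        (sumTo-head j _ (λ l → ℤ.*-zeroˡ (p i (j ∸ suc l))))

*ₚ-separated : ∀ p q → (∀ k l → p k (suc l) ≡ 0ℤ) → (∀ k l → q (suc k) l ≡ 0ℤ) →
  ∀ i j → (p *ₚ q) i j ≡ p i 0 * q 0 j
*ₚ-separated p q p-no-y q-no-x i j = begin
  sumTo i (λ k → sumTo j (λ l → p k l * q (i ∸ k) (j ∸ l)))
    ≡⟨ sumTo-cong i (λ k → sumTo-head j _ (λ l → cong (_* q (i ∸ k) (j ∸ suc l)) (p-no-y k l))) ⟩
  sumTo i (λ k → p k 0 * q (i ∸ k) j)
    ≡⟨ sumTo-last i _ (λ k k<i → trans (cong (p k 0 *_) (q-at-positive k k<i)) (ℤ.*-zeroʳ (p k 0))) ⟩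
  p i 0 * q (i ∸ i) j
    ≡⟨ cong (λ z → p i 0 * q z j) (ℕ.n∸n≡0 i) ⟩
  p i 0 * q 0 j ∎
  where
  open ≡-Reasoning
  q-at-positive : ∀ k → k < i → q (i ∸ k) j ≡ 0ℤ
  q-at-positive k k<i = trans (cong (λ z → q z j) (ℕ.+-∸-assoc 1 k<i)) (q-no-x _ j)

-a+b≡b-a : ∀ a b → -1ℤ * a + 1ℤ * b ≡ b - a
-a+b≡b-a = solve-∀

xₚ-1 : Poly
xₚ-1 = xₚ +ₚ constₚ -1ℤ

yₚ-1 : Poly
yₚ-1 = yₚ +ₚ constₚ -1ℤ

xₚ-1-no-y : ∀ k l → xₚ-1 k (suc l) ≡ 0ℤ
xₚ-1-no-y zero          l = refl
xₚ-1-no-y (suc zero)    l = refl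
xₚ-1-no-y (suc (suc k)) l = refl

xₚ-1-*ₚ-zero : ∀ p j → (xₚ-1 *ₚ p) 0 j ≡ - p 0 j
xₚ-1-*ₚ-zero p j =
  trans (sumTo-head j _ (λ l → cong (_* p 0 (j ∸ suc l)) (xₚ-1-no-y 0 l))) (ℤ.-1*i≡-i (p 0 j))

xₚ-1-*ₚ-suc : ∀ p i j → (xₚ-1 *ₚ p) (suc i) j ≡ p i j - p (suc i) j
xₚ-1-*ₚ-suc p i j = begin
  sumTo (suc i) (λ k → sumTo j (λ l → xₚ-1 k l * p (suc i ∸ k) (j ∸ l)))
    ≡⟨ sumTo-cong (suc i) (λ k → sumTo-head j _ (λ l → cong (_* p (suc i ∸ k) (j ∸ suc l)) (xₚ-1-no-y k l))) ⟩
  sumTo (suc i) (λ k → xₚ-1 k 0 * p (suc i ∸ k) j)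
    ≡⟨ sumTo-head₂ i _ (λ k → ℤ.*-zeroˡ (p (i ∸ suc k) j)) ⟩
  -1ℤ * p (suc i) j + 1ℤ * p i j
    ≡⟨ -a+b≡b-a (p (suc i) j) (p i j) ⟩
  p i j - p (suc i) j ∎
  where open ≡-Reasoning

yₚ-1-*ₚ-zero : ∀ p i → (yₚ-1 *ₚ p) i 0 ≡ - p i 0
yₚ-1-*ₚ-zero p i = trans (sumTo-head i _ (λ k → ℤ.*-zeroˡ (p (i ∸ suc k) 0))) (ℤ.-1*i≡-i (p i 0))

yₚ-1-*ₚ-suc : ∀ p i j → (yₚ-1 *ₚ p) i (suc j) ≡ p i j - p i (suc j)
yₚ-1-*ₚ-suc p i j = begin
  sumTo i (λ k → sumTo (suc j) (λ l → yₚ-1 k l * p (i ∸ k) (suc j ∸ l)))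
    ≡⟨ sumTo-head i _ (λ k → sumTo-≡0 (suc j) _ (λ l _ → ℤ.*-zeroˡ (p (i ∸ suc k) (suc j ∸ l)))) ⟩
  sumTo (suc j) (λ l → yₚ-1 0 l * p i (suc j ∸ l))
    ≡⟨ sumTo-head₂ j _ (λ l → ℤ.*-zeroˡ (p i (j ∸ suc l))) ⟩
  -1ℤ * p i (suc j) + 1ℤ * p i j
    ≡⟨ -a+b≡b-a (p i (suc j)) (p i j) ⟩
  p i j - p i (suc j) ∎
  where open ≡-Reasoning

-- The coefficient of x^v in (x − 1)^u.
signedBinomial : ℕ → ℕ → ℤ
signedBinomial u v = -1ℤ ^ (u ℕ.+ v) * + (u C v)

signedBinomial-suc-zero : ∀ u → signedBinomial (suc u) 0 ≡ - signedBinomial u 0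
signedBinomial-suc-zero u = begin
  -1ℤ * -1ℤ ^ (u ℕ.+ 0) * + 1 ≡⟨ ℤ.*-identityʳ _ ⟩
  -1ℤ * -1ℤ ^ (u ℕ.+ 0)       ≡⟨ ℤ.-1*i≡-i _ ⟩
  - -1ℤ ^ (u ℕ.+ 0)           ≡⟨ cong -_ (sym (ℤ.*-identityʳ _)) ⟩
  - (-1ℤ ^ (u ℕ.+ 0) * + 1)   ∎
  where open ≡-Reasoning

signedBinomial-suc-suc : ∀ u v → signedBinomial (suc u) (suc v) ≡ signedBinomial u v - signedBinomial u (suc v)
signedBinomial-suc-suc u v = begin
  -1ℤ * -1ℤ ^ (u ℕ.+ suc v) * + (suc u C suc v)
    ≡⟨ cong₂ (λ e c → -1ℤ * -1ℤ ^ e * + c) (ℕ.+-suc u v) (sym (nCk+nC[k+1]≡[n+1]C[k+1] u v)) ⟩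
  -1ℤ * (-1ℤ * s) * + (u C v ℕ.+ u C suc v)
    ≡⟨ cong (-1ℤ * (-1ℤ * s) *_) (ℤ.pos-+ (u C v) (u C suc v)) ⟩
  -1ℤ * (-1ℤ * s) * (+ (u C v) + + (u C suc v))
    ≡⟨ pascal s (+ (u C v)) (+ (u C suc v)) ⟩
  s * + (u C v) - -1ℤ * s * + (u C suc v)
    ≡⟨ cong (λ e → s * + (u C v) - -1ℤ ^ e * + (u C suc v)) (sym (ℕ.+-suc u v)) ⟩
  s * + (u C v) - -1ℤ ^ (u ℕ.+ suc v) * + (u C suc v) ∎
  where
  open ≡-Reasoning
  s : ℤ
  s = -1ℤ ^ (u ℕ.+ v)
  pascal : ∀ s a b → -1ℤ * (-1ℤ * s) * (a + b) ≡ s * a - -1ℤ * s * b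
  pascal = solve-∀

xₚ-1^ₚ-no-y : ∀ a i j → (xₚ-1 ^ₚ a) i (suc j) ≡ 0ℤ
xₚ-1^ₚ-no-y zero    zero    j = refl
xₚ-1^ₚ-no-y zero    (suc i) j = refl
xₚ-1^ₚ-no-y (suc a) zero    j = trans (xₚ-1-*ₚ-zero (xₚ-1 ^ₚ a) (suc j)) (cong -_ (xₚ-1^ₚ-no-y a 0 j))
xₚ-1^ₚ-no-y (suc a) (suc i) j =
  trans (xₚ-1-*ₚ-suc (xₚ-1 ^ₚ a) i (suc j)) (cong₂ _-_ (xₚ-1^ₚ-no-y a i j) (xₚ-1^ₚ-no-y a (suc i) j))

xₚ-1^ₚ-coeff : ∀ a i → (xₚ-1 ^ₚ a) i 0 ≡ signedBinomial a i
xₚ-1^ₚ-coeff zero    zero    = refl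
xₚ-1^ₚ-coeff zero    (suc i) = sym (ℤ.*-zeroʳ (-1ℤ ^ suc i))
xₚ-1^ₚ-coeff (suc a) zero    =
  trans (xₚ-1-*ₚ-zero (xₚ-1 ^ₚ a) 0) (trans (cong -_ (xₚ-1^ₚ-coeff a 0)) (sym (signedBinomial-suc-zero a)))
xₚ-1^ₚ-coeff (suc a) (suc i) =
  trans (xₚ-1-*ₚ-suc (xₚ-1 ^ₚ a) i 0)
        (trans (cong₂ _-_ (xₚ-1^ₚ-coeff a i) (xₚ-1^ₚ-coeff a (suc i))) (sym (signedBinomial-suc-suc a i)))

yₚ-1^ₚ-no-x : ∀ b i j → (yₚ-1 ^ₚ b) (suc i) j ≡ 0ℤ
yₚ-1^ₚ-no-x zero    i j       = refl
yₚ-1^ₚ-no-x (suc b) i zero    = trans (yₚ-1-*ₚ-zero (yₚ-1 ^ₚ b) (suc i)) (cong -_ (yₚ-1^ₚ-no-x b i 0))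
yₚ-1^ₚ-no-x (suc b) i (suc j) =
  trans (yₚ-1-*ₚ-suc (yₚ-1 ^ₚ b) (suc i) j) (cong₂ _-_ (yₚ-1^ₚ-no-x b i j) (yₚ-1^ₚ-no-x b i (suc j)))

yₚ-1^ₚ-coeff : ∀ b j → (yₚ-1 ^ₚ b) 0 j ≡ signedBinomial b j
yₚ-1^ₚ-coeff zero    zero    = refl
yₚ-1^ₚ-coeff zero    (suc j) = sym (ℤ.*-zeroʳ (-1ℤ ^ suc j))
yₚ-1^ₚ-coeff (suc b) zero    =
  trans (yₚ-1-*ₚ-zero (yₚ-1 ^ₚ b) 0) (trans (cong -_ (yₚ-1^ₚ-coeff b 0)) (sym (signedBinomial-suc-zero b)))
yₚ-1^ₚ-coeff (suc b) (suc j) =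
  trans (yₚ-1-*ₚ-suc (yₚ-1 ^ₚ b) 0 j)
        (trans (cong₂ _-_ (yₚ-1^ₚ-coeff b j) (yₚ-1^ₚ-coeff b (suc j))) (sym (signedBinomial-suc-suc b j)))

multTutte-coeff : ∀ {n} (MM : MultMatroid n) i j → let open MultMatroid MM in
  multTutte MM i j ≡ Σ[ allSubsets n ] (λ A → + m A * (signedBinomial (rk ⊤ ∸ rk A) i * signedBinomial (∣ A ∣ ∸ rk A) j))
multTutte-coeff {n} MM i j = trans (Σₚ-coeff (allSubsets n) _ i j) (Σ-cong (allSubsets n) term)
  where
  open MultMatroid MM
  term : ∀ A → (constₚ (+ m A) *ₚ ((xₚ-1 ^ₚ (rk ⊤ ∸ rk A)) *ₚ (yₚ-1 ^ₚ (∣ A ∣ ∸ rk A)))) i j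
             ≡ + m A * (signedBinomial (rk ⊤ ∸ rk A) i * signedBinomial (∣ A ∣ ∸ rk A) j)
  term A = trans (constₚ-*ₚ (+ m A) ((xₚ-1 ^ₚ a) *ₚ (yₚ-1 ^ₚ b)) i j) (cong (+ m A *_)
    (trans (*ₚ-separated (xₚ-1 ^ₚ a) (yₚ-1 ^ₚ b) (xₚ-1^ₚ-no-y a) (yₚ-1^ₚ-no-x b) i j)
           (cong₂ _*_ (xₚ-1^ₚ-coeff a i) (yₚ-1^ₚ-coeff b j))))
    where
    a b : ℕ
    a = rk ⊤ ∸ rk A
    b = ∣ A ∣ ∸ rk A

-1^[k+1] : ∀ k → -1ℤ ^ (k ℕ.+ 1) ≡ - -1ℤ ^ k
-1^[k+1] k = trans (cong (-1ℤ ^_) (ℕ.+-comm k 1)) (ℤ.-1*i≡-i _)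

-1^[k+k] : ∀ k → -1ℤ ^ (k ℕ.+ k) ≡ 1ℤ
-1^[k+k] zero    = refl
-1^[k+k] (suc k) = begin
  -1ℤ * -1ℤ ^ (k ℕ.+ suc k)   ≡⟨ cong (λ e → -1ℤ * -1ℤ ^ e) (ℕ.+-suc k k) ⟩
  -1ℤ * (-1ℤ * -1ℤ ^ (k ℕ.+ k)) ≡⟨ sym (ℤ.*-assoc -1ℤ -1ℤ _) ⟩
  1ℤ * -1ℤ ^ (k ℕ.+ k)          ≡⟨ ℤ.*-identityˡ _ ⟩
  -1ℤ ^ (k ℕ.+ k)               ≡⟨ -1^[k+k] k ⟩
  1ℤ                            ∎
  where open ≡-Reasoning

-1^[m∸1] : ∀ {m} → 1 ≤ m → -1ℤ ^ (m ∸ 1) ≡ - -1ℤ ^ m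
-1^[m∸1] {suc m} _ = sym (trans (cong -_ (ℤ.-1*i≡-i (-1ℤ ^ m))) (ℤ.neg-involutive (-1ℤ ^ m)))

-1^[m∸2] : ∀ {m} → 2 ≤ m → -1ℤ ^ (m ∸ 2) ≡ -1ℤ ^ m
-1^[m∸2] {suc zero}    (s≤s ())
-1^[m∸2] {suc (suc m)} _ = sym (trans (sym (ℤ.*-assoc -1ℤ -1ℤ _)) (ℤ.*-identityˡ _))

signedBinomial-diag : ∀ u → signedBinomial u u ≡ 1ℤ
signedBinomial-diag u = cong₂ (λ s c → s * + c) (-1^[k+k] u) (nCn≡1 u)

signedBinomial-vanish : ∀ {u v} → u < v → signedBinomial u v ≡ 0ℤ
signedBinomial-vanish {u} {v} u<v =
  trans (cong (λ c → -1ℤ ^ (u ℕ.+ v) * + c) (k>n⇒nCk≡0 u<v)) (ℤ.*-zeroʳ (-1ℤ ^ (u ℕ.+ v)))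

signedBinomial-pred : ∀ u → signedBinomial (suc u) u ≡ - + suc u
signedBinomial-pred u = begin
  -1ℤ * -1ℤ ^ (u ℕ.+ u) * + (suc u C u)  ≡⟨ cong₂ (λ s c → -1ℤ * s * + c) (-1^[k+k] u) symmetric ⟩
  -1ℤ * 1ℤ * + suc u                     ≡⟨ ℤ.-1*i≡-i (+ suc u) ⟩
  - + suc u                              ∎
  where
  open ≡-Reasoning
  symmetric : suc u C u ≡ suc u
  symmetric = trans (nCk≡nC[n∸k] (ℕ.n≤1+n u)) (trans (cong (suc u C_) (ℕ.m+n∸n≡m 1 u)) (nC1≡n (suc u)))

signedBinomial-pred₂ : ∀ u → signedBinomial (suc (suc u)) u ≡ + (suc (suc u) C 2)
signedBinomial-pred₂ u = begin
  -1ℤ * (-1ℤ * -1ℤ ^ (u ℕ.+ u)) * + (suc (suc u) C u) ≡⟨ cong₂ (λ s c → -1ℤ * (-1ℤ * s) * + c) (-1^[k+k] u) symmetric ⟩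
  1ℤ * + (suc (suc u) C 2)                           ≡⟨ ℤ.*-identityˡ _ ⟩
  + (suc (suc u) C 2)                                ∎
  where
  open ≡-Reasoning
  symmetric : suc (suc u) C u ≡ suc (suc u) C 2
  symmetric = trans (nCk≡nC[n∸k] (ℕ.m≤n⇒m≤1+n (ℕ.n≤1+n u))) (cong (suc (suc u) C_) (ℕ.m+n∸n≡m 2 u))

signedBinomial-zero : ∀ v → signedBinomial v 0 ≡ -1ℤ ^ v
signedBinomial-zero v = trans (ℤ.*-identityʳ _) (cong (-1ℤ ^_) (ℕ.+-identityʳ v))

signedBinomial-one : ∀ v → signedBinomial v 1 ≡ - (-1ℤ ^ v * + v)
signedBinomial-one v = trans (cong₂ (λ s c → s * + c) (-1^[k+1] v) (nC1≡n v)) (sym (ℤ.neg-distribˡ-* (-1ℤ ^ v) (+ v)))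

signedBinomial-two : ∀ v → signedBinomial v 2 ≡ -1ℤ ^ v * + (v C 2)
signedBinomial-two v = cong (λ s → s * + (v C 2)) (trans (cong (-1ℤ ^_) (ℕ.+-comm v 2)) minus-twice)
  where
  minus-twice : -1ℤ * (-1ℤ * -1ℤ ^ v) ≡ -1ℤ ^ v
  minus-twice = trans (sym (ℤ.*-assoc -1ℤ -1ℤ _)) (ℤ.*-identityˡ _)

-- Like coeff, it is 0 at negative exponents; this spares the case r < d in the main computation.
signedBinomialℤ : ℕ → ℤ → ℤ
signedBinomialℤ u (+ v)    = signedBinomial u v
signedBinomialℤ u -[1+ _ ] = 0ℤ

coeff-multTutte : ∀ {n} (MM : MultMatroid n) i j → let open MultMatroid MM in
  coeff (multTutte MM) i j
    ≡ Σ[ allSubsets n ] (λ A → + m A * (signedBinomialℤ (rk ⊤ ∸ rk A) i * signedBinomial (∣ A ∣ ∸ rk A) j))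
coeff-multTutte     MM (+ i)    j = multTutte-coeff MM i j
coeff-multTutte {n} MM -[1+ _ ] j = sym (Σ-≡0 (allSubsets n) _ (λ A → ℤ.*-zeroʳ (+ MultMatroid.m MM A)))

+m-+n≡+[m∸n] : ∀ {m n} → n ≤ m → + m - + n ≡ + (m ∸ n)
+m-+n≡+[m∸n] {m} {n} n≤m = trans (ℤ.m-n≡m⊖n m n) (ℤ.⊖-≥ n≤m)

module _ {r s : ℕ} (s≤r : s ≤ r) where

  signedBinomialℤ-diag : signedBinomialℤ (r ∸ s) (+ r - + s) ≡ 1ℤ
  signedBinomialℤ-diag = trans (cong (signedBinomialℤ (r ∸ s)) (+m-+n≡+[m∸n] s≤r)) (signedBinomial-diag (r ∸ s))

  signedBinomialℤ-pred : signedBinomialℤ (r ∸ s) (+ r - + suc s) ≡ + s - + r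
  signedBinomialℤ-pred with ℕ.m≤n⇒m<n∨m≡n s≤r
  ... | inj₂ refl = trans (cong (signedBinomialℤ (r ∸ r)) r-[1+r]≡-1) (sym (ℤ.+-inverseʳ (+ r)))
    where
    r-[1+r]≡-1 : + r - + suc r ≡ -1ℤ
    r-[1+r]≡-1 = trans (ℤ.m-n≡m⊖n r (suc r)) (trans (ℤ.⊖-< (ℕ.n<1+n r)) (cong (λ k → - + k) (ℕ.m+n∸n≡m 1 r)))
  ... | inj₁ s<r = begin
    signedBinomialℤ (r ∸ s) (+ r - + suc s)   ≡⟨ cong₂ signedBinomialℤ (ℕ.+-∸-assoc 1 s<r) (+m-+n≡+[m∸n] s<r) ⟩
    signedBinomial (suc (r ∸ suc s)) (r ∸ suc s) ≡⟨ signedBinomial-pred (r ∸ suc s) ⟩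
    - + suc (r ∸ suc s)                       ≡⟨ cong (λ k → - + k) (sym (ℕ.+-∸-assoc 1 s<r)) ⟩
    - + (r ∸ s)                               ≡⟨ cong -_ (sym (+m-+n≡+[m∸n] s≤r)) ⟩
    - (+ r - + s)                             ≡⟨ negate-difference (+ r) (+ s) ⟩
    + s - + r                                 ∎
    where
    open ≡-Reasoning
    negate-difference : ∀ a b → - (a - b) ≡ b - a
    negate-difference = solve-∀

  signedBinomialℤ-vanish : ∀ {d} → d < s → signedBinomialℤ (r ∸ s) (+ r - + d) ≡ 0ℤ
  signedBinomialℤ-vanish d<s = trans (cong (signedBinomialℤ (r ∸ s)) (+m-+n≡+[m∸n] (ℕ.≤-trans (ℕ.<⇒≤ d<s) s≤r)))
    (signedBinomial-vanish (ℕ.∸-monoʳ-< d<s s≤r))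

signedBinomialℤ-C2 : ∀ r → signedBinomialℤ r (+ r - + 2) ≡ + (r C 2)
signedBinomialℤ-C2 zero          = refl
signedBinomialℤ-C2 (suc zero)    = refl
signedBinomialℤ-C2 (suc (suc u)) = signedBinomial-pred₂ u

module _ {n : ℕ} where

  ∪-⊆ : {p q r : Subset n} → p ⊆ r → q ⊆ r → p ∪ q ⊆ r
  ∪-⊆ {p} {q} p⊆r q⊆r x∈p∪q = [ p⊆r , q⊆r ]′ (x∈p∪q⁻ p q x∈p∪q)

  ∪-mono : {p q p′ q′ : Subset n} → p ⊆ p′ → q ⊆ q′ → p ∪ q ⊆ p′ ∪ q′
  ∪-mono {p′ = p′} {q′} p⊆p′ q⊆q′ = ∪-⊆ (λ x∈p → p⊆p∪q q′ (p⊆p′ x∈p)) (λ x∈q → q⊆p∪q p′ q′ (q⊆q′ x∈q))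

  ⁅⁆-⊆ : {e : Fin n} {p : Subset n} → e ∈ p → ⁅ e ⁆ ⊆ p
  ⁅⁆-⊆ {e} e∈p x∈⁅e⁆ rewrite x∈⁅y⁆⇒x≡y e x∈⁅e⁆ = e∈p

  ∩-⊆ : {p q r : Subset n} → r ⊆ p → r ⊆ q → r ⊆ p ∩ q
  ∩-⊆ r⊆p r⊆q x∈r = x∈p∩q⁺ (r⊆p x∈r , r⊆q x∈r)

module MatroidProperties {n : ℕ} (M : Matroid n) where
  open Matroid M

  rk-mono′ : ∀ {A B} → A ⊆ B → rk A ≤ rk B
  rk-mono′ {A} {B} = rk-mono A B

  rk-cong : ∀ {A B} → A ⊆ B → B ⊆ A → rk A ≡ rk B
  rk-cong A⊆B B⊆A = cong rk (⊆-antisym A⊆B B⊆A)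

  rk-squeeze : ∀ {A X B k} → A ⊆ X → X ⊆ B → rk A ≡ k → rk B ≡ k → rk X ≡ k
  rk-squeeze A⊆X X⊆B refl rkB≡k = ℕ.≤-antisym (ℕ.≤-trans (rk-mono′ X⊆B) (ℕ.≤-reflexive rkB≡k)) (rk-mono′ A⊆X)

  rk-submodular : ∀ X Y {Z} → Z ⊆ X ∩ Y → rk (X ∪ Y) ℕ.+ rk Z ≤ rk X ℕ.+ rk Y
  rk-submodular X Y Z⊆X∩Y = ℕ.≤-trans (ℕ.+-monoʳ-≤ (rk (X ∪ Y)) (rk-mono′ Z⊆X∩Y)) (rk-sub X Y)

  rk⊥ : rk ⊥ ≡ 0
  rk⊥ = ℕ.n≤0⇒n≡0 (ℕ.≤-trans (rk-card ⊥) (ℕ.≤-reflexive (∣⊥∣≡0 n)))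

  -- k bounds ∣ S ∣, so that passing from S to S ∖ e is a structural step.
  rk-∪-spanned : ∀ B k S → ∣ S ∣ ≤ k → (∀ e → e ∈ S → rk (B ∪ ⁅ e ⁆) ≡ rk B) → rk (B ∪ S) ≡ rk B
  rk-∪-spanned B k S ∣S∣≤k spanned with nonempty? S
  ... | no S-empty = rk-cong (∪-⊆ (λ x → x) (λ {x} x∈S → ⊥-elim (S-empty (x , x∈S)))) (p⊆p∪q S)
  rk-∪-spanned B zero S ∣S∣≤0 spanned | yes (e , e∈S) =
    ⊥-elim (ℕ.n≮0 (ℕ.<-≤-trans (x∈p⇒∣p-x∣<∣p∣ e∈S) ∣S∣≤0))
  rk-∪-spanned B (suc k) S ∣S∣≤1+k spanned | yes (e , e∈S) =
    ℕ.≤-antisym (ℕ.≤-trans (rk-mono′ S-split) rk-X∪Y≤rk-B) (rk-mono′ (p⊆p∪q S))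
    where
    X Y : Subset n
    X = B ∪ (S ∖ e)
    Y = B ∪ ⁅ e ⁆
    rk-X : rk X ≡ rk B
    rk-X = rk-∪-spanned B k (S ∖ e) (ℕ.≤-pred (ℕ.<-≤-trans (x∈p⇒∣p-x∣<∣p∣ e∈S) ∣S∣≤1+k))
      (λ x x∈S∖e → spanned x (p─q⊆p S ⁅ e ⁆ x∈S∖e))
    S-split : B ∪ S ⊆ X ∪ Y
    S-split = ∪-⊆ (λ x∈B → p⊆p∪q Y (p⊆p∪q (S ∖ e) x∈B)) S⊆X∪Y
      where
      S⊆X∪Y : S ⊆ X ∪ Y
      S⊆X∪Y {x} x∈S with x ≟ᶠ e
      ... | yes refl = q⊆p∪q X Y (q⊆p∪q B ⁅ x ⁆ (x∈⁅x⁆ x))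
      ... | no x≢e   = p⊆p∪q Y (q⊆p∪q B (S ∖ e) (x∈p∧x≢y⇒x∈p-y x∈S x≢e))
    rk-X∪Y≤rk-B : rk (X ∪ Y) ≤ rk B
    rk-X∪Y≤rk-B = ℕ.+-cancelʳ-≤ (rk B) (rk (X ∪ Y)) (rk B)
      (subst₂ (λ a b → rk (X ∪ Y) ℕ.+ rk B ≤ a ℕ.+ b) rk-X (spanned e e∈S)
        (rk-submodular X Y (∩-⊆ (p⊆p∪q (S ∖ e)) (p⊆p∪q ⁅ e ⁆))))

  closure : Subset n → Subset n
  closure A = tabulate (λ e → does (rk (A ∪ ⁅ e ⁆) ℕ.≟ rk A))

  ∈closure⁻ : ∀ {A e} → e ∈ closure A → rk (A ∪ ⁅ e ⁆) ≡ rk A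
  ∈closure⁻ {A} {e} e∈clA =
    decided (rk (A ∪ ⁅ e ⁆) ℕ.≟ rk A) (trans (sym (lookup∘tabulate _ e)) ([]=⇒lookup e∈clA))
    where
    decided : (d : Dec (rk (A ∪ ⁅ e ⁆) ≡ rk A)) → does d ≡ true → rk (A ∪ ⁅ e ⁆) ≡ rk A
    decided (yes eq) _ = eq

  ∈closure⁺ : ∀ {A e} → rk (A ∪ ⁅ e ⁆) ≡ rk A → e ∈ closure A
  ∈closure⁺ {A} {e} eq = lookup⇒[]= e (closure A) (trans (lookup∘tabulate _ e) (decided (rk (A ∪ ⁅ e ⁆) ℕ.≟ rk A)))
    where
    decided : (d : Dec (rk (A ∪ ⁅ e ⁆) ≡ rk A)) → does d ≡ true
    decided (yes _)  = refl
    decided (no neq) = ⊥-elim (neq eq)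

  ⊆closure : ∀ A → A ⊆ closure A
  ⊆closure A e∈A = ∈closure⁺ (rk-cong (∪-⊆ (λ x → x) (⁅⁆-⊆ e∈A)) (p⊆p∪q _))

  rk-closure : ∀ A → rk (closure A) ≡ rk A
  rk-closure A = rk-squeeze (⊆closure A) (q⊆p∪q A (closure A)) refl
    (rk-∪-spanned A n (closure A) (∣p∣≤n (closure A)) (λ e → ∈closure⁻))

  closure-flat : ∀ A → IsFlat rk (closure A)
  closure-flat A e eq = ∈closure⁺ (rk-squeeze (p⊆p∪q _) (∪-mono (⊆closure A) (λ x → x)) refl
    (trans eq (rk-closure A)))

  flat-absorbs : ∀ {F Z Y} → IsFlat rk F → Z ⊆ F → Z ⊆ Y → rk Y ≤ rk Z → Y ⊆ F
  flat-absorbs {F} {Z} {Y} F-flat Z⊆F Z⊆Y rkY≤rkZ {e} e∈Y =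
    F-flat e (rk-squeeze (p⊆p∪q _) (∪-mono (λ x → x) (⁅⁆-⊆ e∈Y)) refl (ℕ.≤-antisym rk-F∪Y≤rk-F (rk-mono′ (p⊆p∪q Y))))
    where
    rk-F∪Y≤rk-F : rk (F ∪ Y) ≤ rk F
    rk-F∪Y≤rk-F = ℕ.+-cancelʳ-≤ (rk Z) _ _
      (ℕ.≤-trans (rk-submodular F Y (∩-⊆ Z⊆F Z⊆Y)) (ℕ.+-monoʳ-≤ (rk F) rkY≤rkZ))

  closure-least : ∀ {F A} → IsFlat rk F → A ⊆ F → closure A ⊆ F
  closure-least {A = A} F-flat A⊆F {e} e∈clA =
    flat-absorbs F-flat A⊆F (p⊆p∪q ⁅ e ⁆) (ℕ.≤-reflexive (∈closure⁻ e∈clA)) (q⊆p∪q A ⁅ e ⁆ (x∈⁅x⁆ e))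

  flat≡closure : ∀ {F A} → IsFlat rk F → A ⊆ F → rk F ≡ rk A → F ≡ closure A
  flat≡closure F-flat A⊆F rkF≡rkA = ⊆-antisym
    (λ e∈F → ∈closure⁺ (rk-squeeze (p⊆p∪q _) (∪-⊆ A⊆F (⁅⁆-⊆ e∈F)) refl rkF≡rkA))
    (closure-least F-flat A⊆F)

module LooplessMatroid {n : ℕ} (M : Matroid n) (loopless : Loopless M) where
  open Matroid M
  open MatroidProperties M

  rk⁅⁆ : ∀ e → rk ⁅ e ⁆ ≡ 1
  rk⁅⁆ e with rk ⁅ e ⁆ | rk-card ⁅ e ⁆ | loopless e
  ... | zero        | _      | nonzero = ⊥-elim (nonzero refl)
  ... | suc zero    | _      | _       = refl
  ... | suc (suc k) | rk≤∣⁅e⁆∣ | _       =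
    ⊥-elim (ℕ.<⇒≱ (s≤s (s≤s z≤n)) (ℕ.≤-trans rk≤∣⁅e⁆∣ (ℕ.≤-reflexive (∣⁅x⁆∣≡1 e))))

  1≤rk : ∀ {A e} → e ∈ A → 1 ≤ rk A
  1≤rk {A} {e} e∈A = ℕ.≤-trans (ℕ.≤-reflexive (sym (rk⁅⁆ e))) (rk-mono′ (⁅⁆-⊆ e∈A))

  rk≡0⇒≡⊥ : ∀ {A} → rk A ≡ 0 → A ≡ ⊥
  rk≡0⇒≡⊥ rkA≡0 = ⊆-antisym (λ x∈A → ⊥-elim (ℕ.1+n≰n (ℕ.≤-trans (1≤rk x∈A) (ℕ.≤-reflexive rkA≡0)))) ⊥⊆

  rk-pair⇒parallel : ∀ e f → rk (⁅ e ⁆ ∪ ⁅ f ⁆) ≡ 1 → Parallel rk e f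
  rk-pair⇒parallel e f rk-ef≡1 = rk-ef≡1 , rk⁅⁆ e , rk⁅⁆ f

  Rank1FlatIn : Subset n → Subset n → Set
  Rank1FlatIn G P = (IsFlat rk P × rk P ≡ 1) × P ⊆ G

  parallelClass⇒rank1Flat : ∀ {G P} → IsFlat rk G → IsParallelClass rk G P → Rank1FlatIn G P
  parallelClass⇒rank1Flat {G} {P} G-flat (P⊆G , (e₀ , e₀∈P) , _ , parallel , maximal) = (P-flat , rkP≡1) , P⊆G
    where
    rkP≡1 : rk P ≡ 1
    rkP≡1 = rk-squeeze (⁅⁆-⊆ e₀∈P) (q⊆p∪q ⁅ e₀ ⁆ P) (rk⁅⁆ e₀)
      (trans (rk-∪-spanned ⁅ e₀ ⁆ n P (∣p∣≤n P) (λ f f∈P → trans (proj₁ (parallel e₀ f e₀∈P f∈P)) (sym (rk⁅⁆ e₀))))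
             (rk⁅⁆ e₀))
    P-flat : IsFlat rk P
    P-flat e rk-P∪e≡rkP with e ∈? P
    ... | yes e∈P = e∈P
    ... | no  e∉P = ⊥-elim (maximal e e∈G e∉P (loopless e , λ f f∈P → rk-pair⇒parallel e f (rk-ef f f∈P)))
      where
      e∈G : e ∈ G
      e∈G = flat-absorbs G-flat P⊆G (p⊆p∪q ⁅ e ⁆) (ℕ.≤-reflexive rk-P∪e≡rkP) (q⊆p∪q P ⁅ e ⁆ (x∈⁅x⁆ e))
      rk-ef : ∀ f → f ∈ P → rk (⁅ e ⁆ ∪ ⁅ f ⁆) ≡ 1
      rk-ef f f∈P = rk-squeeze (p⊆p∪q ⁅ f ⁆) (∪-⊆ (q⊆p∪q P ⁅ e ⁆) (λ x → p⊆p∪q ⁅ e ⁆ (⁅⁆-⊆ f∈P x))) (rk⁅⁆ e)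
        (trans rk-P∪e≡rkP rkP≡1)

  rank1Flat⇒parallelClass : ∀ {G P} → Rank1FlatIn G P → IsParallelClass rk G P
  rank1Flat⇒parallelClass {G} {P} ((P-flat , rkP≡1) , P⊆G) = P⊆G , nonempty , (λ e _ → loopless e) , parallel , maximal
    where
    nonempty : Nonempty P
    nonempty with nonempty? P
    ... | yes ne    = ne
    ... | no  empty = ⊥-elim (ℕ.1+n≰n (ℕ.≤-trans (ℕ.≤-reflexive (sym rkP≡1))
                        (ℕ.≤-trans (rk-mono′ {B = ⊥} (λ {x} x∈P → ⊥-elim (empty (x , x∈P)))) (ℕ.≤-reflexive rk⊥))))
    parallel : ∀ e f → e ∈ P → f ∈ P → Parallel rk e f
    parallel e f e∈P f∈P = rk-pair⇒parallel e f (rk-squeeze (p⊆p∪q ⁅ f ⁆) (∪-⊆ (⁅⁆-⊆ e∈P) (⁅⁆-⊆ f∈P)) (rk⁅⁆ e) rkP≡1)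
    maximal : ∀ e → e ∈ G → ¬ (e ∈ P) → ¬ (NonLoop rk e × (∀ f → f ∈ P → Parallel rk e f))
    maximal e _ e∉P (_ , parallel-to-P) = e∉P (flat-absorbs P-flat (⁅⁆-⊆ f∈P) (q⊆p∪q ⁅ e ⁆ ⁅ f ⁆)
      (ℕ.≤-reflexive (trans (proj₁ (parallel-to-P f f∈P)) (sym (rk⁅⁆ f)))) (p⊆p∪q ⁅ f ⁆ (x∈⁅x⁆ e)))
      where
      f : Fin n
      f = proj₁ nonempty
      f∈P : f ∈ P
      f∈P = proj₂ nonempty

  module ContractionByRank1Flat (F : Subset n) (F-flat : IsFlat rk F) (rkF≡1 : rk F ≡ 1) where

    rk/F : Subset n → ℕ
    rk/F = rkContr M F

    rk/F≡1⁺ : ∀ {X} → rk (X ∪ F) ≡ 2 → rk/F X ≡ 1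
    rk/F≡1⁺ rk≡2 rewrite rk≡2 | rkF≡1 = refl

    rk/F≡1⁻ : ∀ {X} → rk/F X ≡ 1 → rk (X ∪ F) ≡ 2
    rk/F≡1⁻ {X} rk/F≡1 rewrite rkF≡1 = minus-one (rk (X ∪ F)) rk/F≡1
      where
      minus-one : ∀ x → x ∸ 1 ≡ 1 → x ≡ 2
      minus-one (suc (suc zero)) refl = refl

    2≤rk-e∪F : ∀ {e} → e ∉ F → 2 ≤ rk (⁅ e ⁆ ∪ F)
    2≤rk-e∪F {e} e∉F with rk (⁅ e ⁆ ∪ F) in eq | rk-mono′ {B = ⁅ e ⁆ ∪ F} (q⊆p∪q ⁅ e ⁆ F)
    ... | suc (suc k) | _    = s≤s (s≤s z≤n)
    ... | zero        | rkF≤0 = ⊥-elim (ℕ.1+n≰n (subst (_≤ 0) rkF≡1 rkF≤0))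
    ... | suc zero    | _    = ⊥-elim (e∉F (F-flat e (trans (trans (rk-cong F∪e⊆e∪F e∪F⊆F∪e) eq) (sym rkF≡1))))
      where
      F∪e⊆e∪F : F ∪ ⁅ e ⁆ ⊆ ⁅ e ⁆ ∪ F
      F∪e⊆e∪F = ∪-⊆ (q⊆p∪q ⁅ e ⁆ F) (p⊆p∪q F)
      e∪F⊆F∪e : ⁅ e ⁆ ∪ F ⊆ F ∪ ⁅ e ⁆
      e∪F⊆F∪e = ∪-⊆ (q⊆p∪q F ⁅ e ⁆) (p⊆p∪q ⁅ e ⁆)

    rk-e∪F≡2 : ∀ {e X} → e ∉ F → ⁅ e ⁆ ∪ F ⊆ X → rk X ≡ 2 → rk (⁅ e ⁆ ∪ F) ≡ 2
    rk-e∪F≡2 e∉F e∪F⊆X rkX≡2 = ℕ.≤-antisym (ℕ.≤-trans (rk-mono′ e∪F⊆X) (ℕ.≤-reflexive rkX≡2)) (2≤rk-e∪F e∉F)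

    Rank2FlatAbove : Subset n → Set
    Rank2FlatAbove G = (IsFlat rk G × rk G ≡ 2) × F ⊆ G

    parallelClass⇒rank2Flat : ∀ P → IsParallelClass rk/F (∁ F) P → Rank2FlatAbove (P ∪ F)
    parallelClass⇒rank2Flat P (P⊆∁F , (e₀ , e₀∈P) , _ , parallel , maximal) = (P∪F-flat , rk-P∪F) , q⊆p∪q P F
      where
      B : Subset n
      B = ⁅ e₀ ⁆ ∪ F
      rkB : rk B ≡ 2
      rkB = rk/F≡1⁻ (proj₁ (proj₂ (parallel e₀ e₀ e₀∈P e₀∈P)))
      B∪f⊆ef∪F : ∀ f → B ∪ ⁅ f ⁆ ⊆ (⁅ e₀ ⁆ ∪ ⁅ f ⁆) ∪ F
      B∪f⊆ef∪F f = ∪-⊆ (∪-mono (p⊆p∪q ⁅ f ⁆) (λ x → x)) (λ x → p⊆p∪q F (q⊆p∪q ⁅ e₀ ⁆ ⁅ f ⁆ x))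
      ef∪F⊆B∪f : ∀ f → (⁅ e₀ ⁆ ∪ ⁅ f ⁆) ∪ F ⊆ B ∪ ⁅ f ⁆
      ef∪F⊆B∪f f = ∪-⊆ (∪-mono (p⊆p∪q F) (λ x → x)) (λ x → p⊆p∪q ⁅ f ⁆ (q⊆p∪q ⁅ e₀ ⁆ F x))
      rk-B∪P : rk (B ∪ P) ≡ rk B
      rk-B∪P = rk-∪-spanned B n P (∣p∣≤n P) (λ f f∈P →
        trans (rk-cong (B∪f⊆ef∪F f) (ef∪F⊆B∪f f)) (trans (rk/F≡1⁻ (proj₁ (parallel e₀ f e₀∈P f∈P))) (sym rkB)))
      rk-P∪F : rk (P ∪ F) ≡ 2
      rk-P∪F = rk-squeeze (∪-mono (⁅⁆-⊆ e₀∈P) (λ x → x)) (∪-⊆ (q⊆p∪q B P) (λ x → p⊆p∪q P (q⊆p∪q ⁅ e₀ ⁆ F x)))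
        rkB (trans rk-B∪P rkB)
      P∪F-flat : IsFlat rk (P ∪ F)
      P∪F-flat e rk≡ with e ∈? (P ∪ F)
      ... | yes e∈P∪F = e∈P∪F
      ... | no  e∉P∪F = ⊥-elim (maximal e (x∉p⇒x∈∁p e∉F) (λ e∈P → e∉P∪F (p⊆p∪q F e∈P)) (nonloop , parallel-to-P))
        where
        e∉F : e ∉ F
        e∉F e∈F = e∉P∪F (q⊆p∪q P F e∈F)
        rk-P∪F∪e : rk ((P ∪ F) ∪ ⁅ e ⁆) ≡ 2
        rk-P∪F∪e = trans rk≡ rk-P∪F
        rk-e∪F : rk (⁅ e ⁆ ∪ F) ≡ 2
        rk-e∪F = rk-e∪F≡2 e∉F (∪-⊆ (q⊆p∪q _ ⁅ e ⁆) (λ x → p⊆p∪q ⁅ e ⁆ (q⊆p∪q P F x))) rk-P∪F∪e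
        nonloop : NonLoop rk/F e
        nonloop rk/F≡0 = ℕ.0≢1+n (trans (sym rk/F≡0) (rk/F≡1⁺ rk-e∪F))
        parallel-to-P : ∀ f → f ∈ P → Parallel rk/F e f
        parallel-to-P f f∈P = rk/F≡1⁺ (rk-squeeze (∪-mono (p⊆p∪q ⁅ f ⁆) (λ x → x))
            (∪-⊆ (∪-⊆ (q⊆p∪q _ ⁅ e ⁆) (λ x → p⊆p∪q ⁅ e ⁆ (p⊆p∪q F (⁅⁆-⊆ f∈P x)))) (λ x → p⊆p∪q ⁅ e ⁆ (q⊆p∪q P F x)))
            rk-e∪F rk-P∪F∪e)
          , rk/F≡1⁺ rk-e∪F , proj₁ (proj₂ (parallel f f f∈P f∈P))

    rank2Flat⇒parallelClass : ∀ G → Rank2FlatAbove G → IsParallelClass rk/F (∁ F) (G ∩ ∁ F)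
    rank2Flat⇒parallelClass G ((G-flat , rkG≡2) , F⊆G) = p∩q⊆q G (∁ F) , nonempty , nonloop , parallel , maximal
      where
      G∖F : Subset n
      G∖F = G ∩ ∁ F
      ∈G∖F⁻ : ∀ {e} → e ∈ G∖F → e ∈ G × e ∉ F
      ∈G∖F⁻ {e} e∈G∖F = p∩q⊆p G (∁ F) e∈G∖F , x∈∁p⇒x∉p (p∩q⊆q G (∁ F) e∈G∖F)
      rk-e∪F : ∀ {e} → e ∈ G∖F → rk (⁅ e ⁆ ∪ F) ≡ 2
      rk-e∪F e∈G∖F = rk-e∪F≡2 (proj₂ (∈G∖F⁻ e∈G∖F)) (∪-⊆ (⁅⁆-⊆ (proj₁ (∈G∖F⁻ e∈G∖F))) F⊆G) rkG≡2
      nonempty : Nonempty G∖F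
      nonempty with nonempty? G∖F
      ... | yes ne    = ne
      ... | no  empty = ⊥-elim (ℕ.<⇒≱ (s≤s (s≤s z≤n))
                          (ℕ.≤-trans (ℕ.≤-reflexive (sym rkG≡2)) (ℕ.≤-trans (rk-mono′ G⊆F) (ℕ.≤-reflexive rkF≡1))))
        where
        G⊆F : G ⊆ F
        G⊆F {x} x∈G with x ∈? F
        ... | yes x∈F = x∈F
        ... | no  x∉F = ⊥-elim (empty (x , x∈p∩q⁺ (x∈G , x∉p⇒x∈∁p x∉F)))
      nonloop : ∀ e → e ∈ G∖F → NonLoop rk/F e
      nonloop e e∈G∖F rk/F≡0 = ℕ.0≢1+n (trans (sym rk/F≡0) (rk/F≡1⁺ (rk-e∪F e∈G∖F)))
      parallel : ∀ e f → e ∈ G∖F → f ∈ G∖F → Parallel rk/F e f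
      parallel e f e∈G∖F f∈G∖F =
        rk/F≡1⁺ (rk-squeeze (∪-mono (p⊆p∪q ⁅ f ⁆) (λ x → x))
          (∪-⊆ (∪-⊆ (⁅⁆-⊆ (proj₁ (∈G∖F⁻ e∈G∖F))) (⁅⁆-⊆ (proj₁ (∈G∖F⁻ f∈G∖F)))) F⊆G) (rk-e∪F e∈G∖F) rkG≡2)
        , rk/F≡1⁺ (rk-e∪F e∈G∖F) , rk/F≡1⁺ (rk-e∪F f∈G∖F)
      maximal : ∀ e → e ∈ ∁ F → ¬ (e ∈ G∖F) → ¬ (NonLoop rk/F e × (∀ f → f ∈ G∖F → Parallel rk/F e f))
      maximal e e∈∁F e∉G∖F (_ , parallel-to-G∖F) = e∉G∖F (x∈p∩q⁺ (e∈G , e∈∁F))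
        where
        f : Fin n
        f = proj₁ nonempty
        f∈G∖F : f ∈ G∖F
        f∈G∖F = proj₂ nonempty
        e∈G : e ∈ G
        e∈G = flat-absorbs G-flat (∪-⊆ (⁅⁆-⊆ (proj₁ (∈G∖F⁻ f∈G∖F))) F⊆G) (∪-mono (q⊆p∪q ⁅ e ⁆ ⁅ f ⁆) (λ x → x))
          (ℕ.≤-reflexive (trans (rk/F≡1⁻ (proj₁ (parallel-to-G∖F f f∈G∖F))) (sym (rk-e∪F f∈G∖F))))
          (p⊆p∪q F (p⊆p∪q ⁅ f ⁆ (x∈⁅x⁆ e)))

    [P∪F]∖F≡P : ∀ P → IsParallelClass rk/F (∁ F) P → (P ∪ F) ∩ ∁ F ≡ P
    [P∪F]∖F≡P P (P⊆∁F , _) = ⊆-antisym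
      (λ {x} x∈ → [ (λ x∈P → x∈P) , (λ x∈F → ⊥-elim (x∈∁p⇒x∉p (p∩q⊆q _ (∁ F) x∈) x∈F)) ]′ (x∈p∪q⁻ P F (p∩q⊆p _ (∁ F) x∈)))
      (λ x∈P → x∈p∩q⁺ (p⊆p∪q F x∈P , P⊆∁F x∈P))

    [G∖F]∪F≡G : ∀ G → Rank2FlatAbove G → (G ∩ ∁ F) ∪ F ≡ G
    [G∖F]∪F≡G G (_ , F⊆G) = ⊆-antisym (∪-⊆ (p∩q⊆p G (∁ F)) F⊆G) G⊆[G∖F]∪F
      where
      G⊆[G∖F]∪F : G ⊆ (G ∩ ∁ F) ∪ F
      G⊆[G∖F]∪F {x} x∈G with x ∈? F
      ... | yes x∈F = q⊆p∪q _ F x∈F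
      ... | no  x∉F = p⊆p∪q F (x∈p∩q⁺ (x∈G , x∉p⇒x∈∁p x∉F))

  ∣⁅e⁆∪⁅f⁆∣≡2 : ∀ {m} (e f : Fin m) → ¬ e ≡ f → ∣ ⁅ e ⁆ ∪ ⁅ f ⁆ ∣ ≡ 2
  ∣⁅e⁆∪⁅f⁆∣≡2 Fin.zero    Fin.zero    e≢f = ⊥-elim (e≢f refl)
  ∣⁅e⁆∪⁅f⁆∣≡2 Fin.zero    (Fin.suc f) _   = cong suc (trans (cong ∣_∣ (∪-identityˡ ⁅ f ⁆)) (∣⁅x⁆∣≡1 f))
  ∣⁅e⁆∪⁅f⁆∣≡2 (Fin.suc e) Fin.zero    _   = cong suc (trans (cong ∣_∣ (∪-identityʳ ⁅ e ⁆)) (∣⁅x⁆∣≡1 e))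
  ∣⁅e⁆∪⁅f⁆∣≡2 (Fin.suc e) (Fin.suc f) e≢f = ∣⁅e⁆∪⁅f⁆∣≡2 e f (λ e≡f → e≢f (cong Fin.suc e≡f))

  pair-circuit : ∀ {F e f} → rk F ≡ 1 → e ∈ F → f ∈ F → ¬ e ≡ f → IsCircuit rk (⁅ e ⁆ ∪ ⁅ f ⁆)
  pair-circuit {F} {e} {f} rkF≡1 e∈F f∈F e≢f = size-rank rk-pair , λ x x∈pair → size-rank (rk-pair∖ x x∈pair)
    where
    pair : Subset n
    pair = ⁅ e ⁆ ∪ ⁅ f ⁆
    size-rank : ∀ {X} → rk X ≡ 1 → rk X ℕ.+ 1 ≡ ∣ pair ∣
    size-rank rk≡1 = trans (cong (ℕ._+ 1) rk≡1) (sym (∣⁅e⁆∪⁅f⁆∣≡2 e f e≢f))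
    pair⊆F : pair ⊆ F
    pair⊆F = ∪-⊆ (⁅⁆-⊆ e∈F) (⁅⁆-⊆ f∈F)
    rk-in-F : ∀ {X y} → X ⊆ F → y ∈ X → rk X ≡ 1
    rk-in-F X⊆F y∈X = ℕ.≤-antisym (ℕ.≤-trans (rk-mono′ X⊆F) (ℕ.≤-reflexive rkF≡1)) (1≤rk y∈X)
    rk-pair : rk pair ≡ 1
    rk-pair = rk-in-F pair⊆F (p⊆p∪q ⁅ f ⁆ (x∈⁅x⁆ e))
    rk-pair∖ : ∀ x → x ∈ pair → rk (pair ∖ x) ≡ 1
    rk-pair∖ x x∈pair with x ≟ᶠ e
    ... | yes refl = rk-in-F (λ y → pair⊆F (p─q⊆p pair ⁅ x ⁆ y))
                       (x∈p∧x≢y⇒x∈p-y (q⊆p∪q ⁅ e ⁆ ⁅ f ⁆ (x∈⁅x⁆ f)) (λ f≡e → e≢f (sym f≡e)))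
    ... | no x≢e   = rk-in-F (λ y → pair⊆F (p─q⊆p pair ⁅ x ⁆ y))
                       (x∈p∧x≢y⇒x∈p-y (p⊆p∪q ⁅ f ⁆ (x∈⁅x⁆ e)) (λ e≡x → x≢e (sym e≡x)))

  rank1Flat-cyclic : ∀ {F A} → IsFlat rk F → rk F ≡ 1 → A ⊆ F → 2 ≤ ∣ A ∣ → IsCyclicFlat rk F
  rank1Flat-cyclic {F} {A} F-flat rkF≡1 A⊆F 2≤∣A∣ = F-flat , λ e e∈F →
    let (f , f∈A , e≢f) = other e in
    ⁅ e ⁆ ∪ ⁅ f ⁆ , (∪-⊆ (⁅⁆-⊆ e∈F) (⁅⁆-⊆ (A⊆F f∈A)) , pair-circuit rkF≡1 e∈F (A⊆F f∈A) e≢f) , p⊆p∪q ⁅ f ⁆ (x∈⁅x⁆ e)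
    where
    other : ∀ e → ∃ λ f → f ∈ A × ¬ e ≡ f
    other e with any? (λ x → (x ∈? A) ×-dec ¬? (e ≟ᶠ x))
    ... | yes (f , f∈A , e≢f) = f , f∈A , e≢f
    ... | no  none = ⊥-elim (ℕ.<⇒≱ 2≤∣A∣ (ℕ.≤-trans (p⊆q⇒∣p∣≤∣q∣ A⊆⁅e⁆) (ℕ.≤-reflexive (∣⁅x⁆∣≡1 e))))
      where
      A⊆⁅e⁆ : A ⊆ ⁅ e ⁆
      A⊆⁅e⁆ {x} x∈A with e ≟ᶠ x
      ... | yes refl = x∈⁅x⁆ x
      ... | no  e≢x  = ⊥-elim (none (x , x∈A , e≢x))

module _ {n : ℕ} where

  Σ⊇ : {D : Subset n → Set} → (∀ F → Dec (D F)) → (Subset n → ℤ) → Subset n → ℤ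
  Σ⊇ D? w A = Σ[ allSubsets n ] (λ F → 𝟙 (D? F) * 𝟙 (A ⊆? F) * w F)

  Σ⊇-⊥ : ∀ {D : Subset n → Set} (D? : ∀ F → Dec (D F)) w → Σ⊇ D? w ⊥ ≡ Σ[ allSubsets n ] (λ F → 𝟙 (D? F) * w F)
  Σ⊇-⊥ D? w = Σ-cong (allSubsets n) (λ F →
    cong (_* w F) (trans (cong (𝟙 (D? F) *_) (𝟙-yes (⊥ ⊆? F) ⊥⊆)) (ℤ.*-identityʳ (𝟙 (D? F)))))

  Σ⊇-unique : ∀ {D : Subset n → Set} (D? : ∀ F → Dec (D F)) w A F₀ →
    (∀ F → D F → A ⊆ F → F ≡ F₀) → D F₀ → A ⊆ F₀ → Σ⊇ D? w A ≡ w F₀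
  Σ⊇-unique D? w A F₀ unique dF₀ A⊆F₀ =
    trans (Σ-cong (allSubsets n) (λ F → cong (_* w F) (sym (𝟙-× (D? F) (A ⊆? F)))))
          (Σ-𝟙-unique (λ F → D? F ×-dec (A ⊆? F)) F₀ w (λ F (dF , A⊆F) → unique F dF A⊆F) (dF₀ , A⊆F₀))

  Σ⊇-none : ∀ {D : Subset n → Set} (D? : ∀ F → Dec (D F)) w A → (∀ F → D F → ¬ A ⊆ F) → Σ⊇ D? w A ≡ 0ℤ
  Σ⊇-none D? w A none = Σ-≡0 (allSubsets n) _ (λ F → cong (_* w F)
    (trans (sym (𝟙-× (D? F) (A ⊆? F))) (𝟙-no (D? F ×-dec (A ⊆? F)) (λ (dF , A⊆F) → none F dF A⊆F))))

  Σ-over-subsets-swap : ∀ {D : Subset n → Set} {I : Subset n → Subset n → Set}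
    (D? : ∀ F → Dec (D F)) (I? : ∀ F A → Dec (I F A)) (w g : Subset n → ℤ) →
    Σ[ filter D? (allSubsets n) ] (λ F → w F * Σ[ filter (I? F) (allSubsets n) ] g)
      ≡ Σ[ allSubsets n ] (λ A → g A * Σ[ allSubsets n ] (λ F → 𝟙 (D? F) * 𝟙 (I? F A) * w F))
  Σ-over-subsets-swap D? I? w g = begin
    Σ[ filter D? 𝒮 ] (λ F → w F * Σ[ filter (I? F) 𝒮 ] g)
      ≡⟨ Σ-filter D? 𝒮 _ ⟩
    Σ[ 𝒮 ] (λ F → 𝟙 (D? F) * (w F * Σ[ filter (I? F) 𝒮 ] g))
      ≡⟨ Σ-cong 𝒮 (λ F → cong (λ z → 𝟙 (D? F) * (w F * z)) (Σ-filter (I? F) 𝒮 g)) ⟩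
    Σ[ 𝒮 ] (λ F → 𝟙 (D? F) * (w F * Σ[ 𝒮 ] (λ A → 𝟙 (I? F A) * g A)))
      ≡⟨ Σ-cong 𝒮 (λ F → trans (cong (𝟙 (D? F) *_) (sym (Σ-*ˡ 𝒮 (w F) _))) (sym (Σ-*ˡ 𝒮 (𝟙 (D? F)) _))) ⟩
    Σ[ 𝒮 ] (λ F → Σ[ 𝒮 ] (λ A → 𝟙 (D? F) * (w F * (𝟙 (I? F A) * g A))))
      ≡⟨ Σ-swap 𝒮 𝒮 _ ⟩
    Σ[ 𝒮 ] (λ A → Σ[ 𝒮 ] (λ F → 𝟙 (D? F) * (w F * (𝟙 (I? F A) * g A))))
      ≡⟨ Σ-cong 𝒮 (λ A → trans (Σ-cong 𝒮 (λ F → reorder (𝟙 (D? F)) (w F) (𝟙 (I? F A)) (g A))) (Σ-*ˡ 𝒮 (g A) _)) ⟩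
    Σ[ 𝒮 ] (λ A → g A * Σ[ 𝒮 ] (λ F → 𝟙 (D? F) * 𝟙 (I? F A) * w F)) ∎
    where
    open ≡-Reasoning
    𝒮 = allSubsets n
    reorder : ∀ d w i g → d * (w * (i * g)) ≡ g * (d * i * w)
    reorder = solve-∀

  Σ-over-subsets≥ : ∀ {D : Subset n → Set} (D? : ∀ F → Dec (D F)) k w A →
    Σ[ allSubsets n ] (λ F → 𝟙 (D? F) * 𝟙 ((A ⊆? F) ×-dec (k ℕ.≤? ∣ A ∣)) * w F) ≡ 𝟙 (k ℕ.≤? ∣ A ∣) * Σ⊇ D? w A
  Σ-over-subsets≥ D? k w A = trans
    (Σ-cong (allSubsets n) (λ F → trans (cong (λ z → 𝟙 (D? F) * z * w F) (𝟙-× (A ⊆? F) (k ℕ.≤? ∣ A ∣)))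
      (reorder (𝟙 (D? F)) (𝟙 (A ⊆? F)) (𝟙 (k ℕ.≤? ∣ A ∣)) (w F))))
    (Σ-*ˡ (allSubsets n) (𝟙 (k ℕ.≤? ∣ A ∣)) _)
    where
    reorder : ∀ d a k w → d * (a * k) * w ≡ k * (d * a * w)
    reorder = solve-∀

module Coefficients {n : ℕ} (MM : MultMatroid n) (loopless : Loopless (MultMatroid.matroid MM)) where
  open MultMatroid MM
  open MatroidProperties matroid
  open LooplessMatroid matroid loopless

  𝒮 : List (Subset n)
  𝒮 = allSubsets n

  r : ℕ
  r = rkM matroid

  flat? : ∀ k F → Dec (IsFlat rk F × rk F ≡ k)
  flat? k F = isFlat? rk F ×-dec (rk F ℕ.≟ k)

  cyclicFlat? : ∀ k F → Dec (IsCyclicFlat rk F × rk F ≡ k)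
  cyclicFlat? k F = isCyclicFlat? rk F ×-dec (rk F ℕ.≟ k)

  one : Subset n → ℤ
  one _ = 1ℤ

  ⊤-flat : IsFlat rk ⊤
  ⊤-flat e _ = ∈⊤

  pM≡#flats₁ : + pM matroid ≡ Σ[ 𝒮 ] (λ F → 𝟙 (flat? 1 F))
  pM≡#flats₁ = trans (length-filter (isParallelClass? rk ⊤) 𝒮) (Σ-cong 𝒮 (λ P →
    𝟙-⇔ (isParallelClass? rk ⊤ P) (flat? 1 P) (λ class → proj₁ (parallelClass⇒rank1Flat ⊤-flat class))
        (λ flat₁ → rank1Flat⇒parallelClass (flat₁ , ⊆⊤))))

  pRestr≡#flats₁⊆ : ∀ {G} → IsFlat rk G → + pRestr matroid G ≡ Σ[ 𝒮 ] (λ F → 𝟙 (flat? 1 F) * 𝟙 (F ⊆? G))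
  pRestr≡#flats₁⊆ {G} G-flat = trans (length-filter (isParallelClass? rk G) 𝒮) (Σ-cong 𝒮 (λ P →
    trans (𝟙-⇔ (isParallelClass? rk G P) (flat? 1 P ×-dec (P ⊆? G)) (parallelClass⇒rank1Flat G-flat) rank1Flat⇒parallelClass)
          (𝟙-× (flat? 1 P) (P ⊆? G))))

  pContr≡#flats₂⊇ : ∀ {F} → IsFlat rk F → rk F ≡ 1 → + pContr matroid F ≡ Σ⊇ (flat? 2) one F
  pContr≡#flats₂⊇ {F} F-flat rkF≡1 = begin
    + pContr matroid F
      ≡⟨ length-filter (isParallelClass? rk/F (∁ F)) 𝒮 ⟩
    Σ[ 𝒮 ] (λ P → 𝟙 (isParallelClass? rk/F (∁ F) P))
      ≡⟨ Σ-𝟙-bijection (isParallelClass? rk/F (∁ F)) (λ G → flat? 2 G ×-dec (F ⊆? G)) (_∪ F) (λ G → G Data.Fin.Subset.∩ ∁ F)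
           parallelClass⇒rank2Flat rank2Flat⇒parallelClass [P∪F]∖F≡P [G∖F]∪F≡G ⟩
    Σ[ 𝒮 ] (λ G → 𝟙 (flat? 2 G ×-dec (F ⊆? G)))
      ≡⟨ Σ-cong 𝒮 (λ G → trans (𝟙-× (flat? 2 G) (F ⊆? G)) (sym (ℤ.*-identityʳ _))) ⟩
    Σ⊇ (flat? 2) one F ∎
    where
    open ≡-Reasoning
    open ContractionByRank1Flat F F-flat rkF≡1

  Σ-pContr≡Σ-pRestr : Σ[ 𝒮 ] (λ F → 𝟙 (flat? 1 F) * + pContr matroid F) ≡ Σ[ 𝒮 ] (λ G → 𝟙 (flat? 2 G) * + pRestr matroid G)
  Σ-pContr≡Σ-pRestr = begin
    Σ[ 𝒮 ] (λ F → 𝟙 (flat? 1 F) * + pContr matroid F)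
      ≡⟨ Σ-cong 𝒮 (λ F → 𝟙-*-cong (flat? 1 F) (λ (F-flat , rkF≡1) → pContr≡#flats₂⊇ F-flat rkF≡1)) ⟩
    Σ[ 𝒮 ] (λ F → 𝟙 (flat? 1 F) * Σ⊇ (flat? 2) one F)
      ≡⟨ Σ-cong 𝒮 (λ F → sym (Σ-*ˡ 𝒮 (𝟙 (flat? 1 F)) _)) ⟩
    Σ[ 𝒮 ] (λ F → Σ[ 𝒮 ] (λ G → 𝟙 (flat? 1 F) * (𝟙 (flat? 2 G) * 𝟙 (F ⊆? G) * 1ℤ)))
      ≡⟨ Σ-swap 𝒮 𝒮 _ ⟩
    Σ[ 𝒮 ] (λ G → Σ[ 𝒮 ] (λ F → 𝟙 (flat? 1 F) * (𝟙 (flat? 2 G) * 𝟙 (F ⊆? G) * 1ℤ)))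
      ≡⟨ Σ-cong 𝒮 (λ G → trans (Σ-cong 𝒮 (λ F → reorder (𝟙 (flat? 1 F)) (𝟙 (flat? 2 G)) (𝟙 (F ⊆? G))))
                                (Σ-*ˡ 𝒮 (𝟙 (flat? 2 G)) _)) ⟩
    Σ[ 𝒮 ] (λ G → 𝟙 (flat? 2 G) * Σ[ 𝒮 ] (λ F → 𝟙 (flat? 1 F) * 𝟙 (F ⊆? G)))
      ≡⟨ Σ-cong 𝒮 (λ G → 𝟙-*-cong (flat? 2 G) (λ (G-flat , _) → sym (pRestr≡#flats₁⊆ G-flat))) ⟩
    Σ[ 𝒮 ] (λ G → 𝟙 (flat? 2 G) * + pRestr matroid G) ∎
    where
    open ≡-Reasoning
    reorder : ∀ a b c → a * (b * c * 1ℤ) ≡ b * (a * c)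
    reorder = solve-∀

  rk≤r : ∀ A → rk A ≤ r
  rk≤r A = rk-mono′ ⊆⊤

  Σ⊇-closure : ∀ k w A → rk A ≡ k → Σ⊇ (flat? k) w A ≡ w (closure A)
  Σ⊇-closure k w A rkA≡k = Σ⊇-unique (flat? k) w A (closure A)
    (λ F (F-flat , rkF≡k) A⊆F → flat≡closure F-flat A⊆F (trans rkF≡k (sym rkA≡k)))
    (closure-flat A , trans (rk-closure A) rkA≡k) (⊆closure A)

  Σ⊇-cyclic-closure : ∀ w A → rk A ≡ 1 → 2 ≤ ∣ A ∣ → Σ⊇ (cyclicFlat? 1) w A ≡ w (closure A)
  Σ⊇-cyclic-closure w A rkA≡1 2≤∣A∣ = Σ⊇-unique (cyclicFlat? 1) w A (closure A)
    (λ F ((F-flat , _) , rkF≡1) A⊆F → flat≡closure F-flat A⊆F (trans rkF≡1 (sym rkA≡1)))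
    (rank1Flat-cyclic (closure-flat A) rkclA≡1 (⊆closure A) 2≤∣A∣ , rkclA≡1) (⊆closure A)
    where
    rkclA≡1 : rk (closure A) ≡ 1
    rkclA≡1 = trans (rk-closure A) rkA≡1

  Σ⊇-vanish : ∀ {D : Subset n → Set} (D? : ∀ F → Dec (D F)) {k} w A →
    (∀ F → D F → rk F ≡ k) → k < rk A → Σ⊇ D? w A ≡ 0ℤ
  Σ⊇-vanish D? w A rank-k k<rkA = Σ⊇-none D? w A (λ F dF A⊆F →
    ℕ.<⇒≱ k<rkA (ℕ.≤-trans (rk-mono′ A⊆F) (ℕ.≤-reflexive (rank-k F dF))))

  Σ⊇-flats-vanish : ∀ k w A → k < rk A → Σ⊇ (flat? k) w A ≡ 0ℤ
  Σ⊇-flats-vanish k w A = Σ⊇-vanish (flat? k) w A (λ _ (_ , rkF≡k) → rkF≡k)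

  Σ⊇-cyclicFlats-vanish : ∀ w A → 1 < rk A → Σ⊇ (cyclicFlat? 1) w A ≡ 0ℤ
  Σ⊇-cyclicFlats-vanish w A = Σ⊇-vanish (cyclicFlat? 1) w A (λ _ (_ , rkF≡1) → rkF≡1)

  #flats₂⊇-rank1 : ∀ A → rk A ≡ 1 → Σ⊇ (flat? 2) one A ≡ + pContr matroid (closure A)
  #flats₂⊇-rank1 A rkA≡1 = trans
    (Σ-cong 𝒮 (λ G → cong (_* 1ℤ) (𝟙-*-cong (flat? 2 G) (λ (G-flat , _) →
      𝟙-⇔ (A ⊆? G) (closure A ⊆? G) (closure-least G-flat) (λ clA⊆G x∈A → clA⊆G (⊆closure A x∈A))))))
    (sym (pContr≡#flats₂⊇ (closure-flat A) (trans (rk-closure A) rkA≡1)))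

  #flats₁⊇⊥ : Σ⊇ (flat? 1) one ⊥ ≡ + pM matroid
  #flats₁⊇⊥ = trans (Σ⊇-⊥ (flat? 1) one) (trans (Σ-cong 𝒮 (λ F → ℤ.*-identityʳ _)) (sym pM≡#flats₁))

  w₁ : Subset n → ℤ
  w₁ F = + pContr matroid F - + r + + 1

  constant₃ : ℤ
  constant₃ = + (r C 2) - (+ r - + 1) * + pM matroid + Σ[ flats matroid 2 ] (λ F → + pRestr matroid F - + 1)

  -- The constant of (3) is what the empty set needs: double counting turns Σ_{F₂} p(F) into Σ_{F₁} p(M/F).
  constant₃≡ : constant₃ ≡ + (r C 2) + Σ⊇ (flat? 1) w₁ ⊥ - Σ⊇ (flat? 2) one ⊥
  constant₃≡ = begin
    + (r C 2) - (+ r - + 1) * + pM matroid + Σ[ filter (flat? 2) 𝒮 ] (λ F → + pRestr matroid F - + 1)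
      ≡⟨ cong₂ (λ p s → + (r C 2) - (+ r - + 1) * p + s) pM≡#flats₁ (Σ-filter (flat? 2) 𝒮 _) ⟩
    + (r C 2) - (+ r - + 1) * #F₁ + Σ[ 𝒮 ] (λ F → 𝟙 (flat? 2 F) * (+ pRestr matroid F - + 1))
      ≡⟨ cong (_+_ (+ (r C 2) - (+ r - + 1) * #F₁)) (trans (Σ-cong 𝒮 (λ F → split₂ (𝟙 (flat? 2 F)) _)) (Σ-+ 𝒮 _ _)) ⟩
    + (r C 2) - (+ r - + 1) * #F₁ + (Σp₂ + Σ[ 𝒮 ] (λ F → - 𝟙 (flat? 2 F)))
      ≡⟨ cong (λ s → + (r C 2) - (+ r - + 1) * #F₁ + (s + Σ[ 𝒮 ] (λ F → - 𝟙 (flat? 2 F)))) (sym Σ-pContr≡Σ-pRestr) ⟩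
    + (r C 2) - (+ r - + 1) * #F₁ + (Σp₁ + Σ[ 𝒮 ] (λ F → - 𝟙 (flat? 2 F)))
      ≡⟨ cong (λ s → + (r C 2) - (+ r - + 1) * #F₁ + (Σp₁ + s)) (trans (Σ-cong 𝒮 (λ F → sym (ℤ.-1*i≡-i _))) (Σ-*ˡ 𝒮 -1ℤ _)) ⟩
    + (r C 2) - (+ r - + 1) * #F₁ + (Σp₁ + -1ℤ * #F₂)
      ≡⟨ regroup (+ (r C 2)) (+ r) #F₁ Σp₁ #F₂ ⟩
    + (r C 2) + (Σp₁ + (1ℤ - + r) * #F₁) - #F₂
      ≡⟨ cong₂ (λ a b → + (r C 2) + a - b) (sym Σ⊇-w₁-⊥) (sym #flats₂⊇⊥) ⟩
    + (r C 2) + Σ⊇ (flat? 1) w₁ ⊥ - Σ⊇ (flat? 2) one ⊥ ∎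
    where
    open ≡-Reasoning
    #F₁ #F₂ Σp₁ Σp₂ : ℤ
    #F₁ = Σ[ 𝒮 ] (λ F → 𝟙 (flat? 1 F))
    #F₂ = Σ[ 𝒮 ] (λ F → 𝟙 (flat? 2 F))
    Σp₁ = Σ[ 𝒮 ] (λ F → 𝟙 (flat? 1 F) * + pContr matroid F)
    Σp₂ = Σ[ 𝒮 ] (λ G → 𝟙 (flat? 2 G) * + pRestr matroid G)
    split₂ : ∀ d p → d * (p - + 1) ≡ d * p + - d
    split₂ = solve-∀
    regroup : ∀ c r f p g → c - (r - 1ℤ) * f + (p + -1ℤ * g) ≡ c + (p + (1ℤ - r) * f) - g
    regroup = solve-∀
    split₁ : ∀ d p r → d * (p - r + 1ℤ) ≡ d * p + (1ℤ - r) * d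
    split₁ = solve-∀
    Σ⊇-w₁-⊥ : Σ⊇ (flat? 1) w₁ ⊥ ≡ Σp₁ + (1ℤ - + r) * #F₁
    Σ⊇-w₁-⊥ = trans (Σ⊇-⊥ (flat? 1) w₁) (trans (Σ-cong 𝒮 (λ F → split₁ (𝟙 (flat? 1 F)) _ (+ r)))
      (trans (Σ-+ 𝒮 _ _) (cong (_+_ Σp₁) (Σ-*ˡ 𝒮 (1ℤ - + r) _))))
    #flats₂⊇⊥ : Σ⊇ (flat? 2) one ⊥ ≡ #F₂
    #flats₂⊇⊥ = trans (Σ⊇-⊥ (flat? 2) one) (Σ-cong 𝒮 (λ F → ℤ.*-identityʳ _))

  μ : Subset n → ℤ
  μ A = + m A

  Σ-μ-collect : ∀ (f g : Subset n → ℤ) →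
    Σ[ 𝒮 ] (λ A → μ A * f A) + Σ[ 𝒮 ] (λ A → μ A * g A) ≡ Σ[ 𝒮 ] (λ A → μ A * (f A + g A))
  Σ-μ-collect f g = trans (sym (Σ-+ 𝒮 (λ A → μ A * f A) (λ A → μ A * g A)))
    (Σ-cong 𝒮 (λ A → sym (ℤ.*-distribˡ-+ (μ A) (f A) (g A))))

  μ⊥-as-Σ : ∀ K → K * μ ⊥ ≡ Σ[ 𝒮 ] (λ A → μ A * (𝟙 (A ≟ˢ ⊥) * K))
  μ⊥-as-Σ K = sym (trans (Σ-cong 𝒮 (λ A → reorder (μ A) (𝟙 (A ≟ˢ ⊥)) K))
                         (Σ-𝟙-unique (_≟ˢ ⊥) ⊥ (λ A → K * μ A) (λ _ A≡⊥ → A≡⊥) refl))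
    where
    reorder : ∀ μ i K → μ * (i * K) ≡ i * (K * μ)
    reorder = solve-∀

  Σ-flats-subsetsOf : ∀ {D : Subset n → Set} (D? : ∀ F → Dec (D F)) (w s : Subset n → ℤ) →
    Σ[ filter D? 𝒮 ] (λ F → w F * Σ[ subsetsOf F ] (λ A → s A * μ A)) ≡ Σ[ 𝒮 ] (λ A → μ A * (s A * Σ⊇ D? w A))
  Σ-flats-subsetsOf D? w s = trans (Σ-over-subsets-swap D? (λ F A → A ⊆? F) w (λ A → s A * μ A))
    (Σ-cong 𝒮 (λ A → reorder (s A) (μ A) (Σ⊇ D? w A)))
    where
    reorder : ∀ s μ N → s * μ * N ≡ μ * (s * N)
    reorder = solve-∀

  Σ-flats-subsetsOf≥ : ∀ {D : Subset n → Set} (D? : ∀ F → Dec (D F)) k (w s : Subset n → ℤ) →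
    Σ[ filter D? 𝒮 ] (λ F → w F * Σ[ subsetsOf≥ k F ] (λ A → s A * μ A))
      ≡ Σ[ 𝒮 ] (λ A → μ A * (s A * (𝟙 (k ℕ.≤? ∣ A ∣) * Σ⊇ D? w A)))
  Σ-flats-subsetsOf≥ D? k w s =
    trans (Σ-over-subsets-swap D? (λ F A → (A ⊆? F) ×-dec (k ℕ.≤? ∣ A ∣)) w (λ A → s A * μ A))
          (Σ-cong 𝒮 (λ A → trans (cong (s A * μ A *_) (Σ-over-subsets≥ D? k w A))
                                 (reorder (s A) (μ A) (𝟙 (k ℕ.≤? ∣ A ∣) * Σ⊇ D? w A))))
    where
    reorder : ∀ s μ N → s * μ * N ≡ μ * (s * N)
    reorder = solve-∀

  Σ-weight-one : ∀ (Fs : List (Subset n)) (h : Subset n → ℤ) → Σ[ Fs ] h ≡ Σ[ Fs ] (λ F → one F * h F)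
  Σ-weight-one Fs h = Σ-cong Fs (λ F → sym (ℤ.*-identityˡ (h F)))

  xFactor : ℕ → Subset n → ℤ
  xFactor d A = signedBinomialℤ (r ∸ rk A) (+ r - + d)

  yFactor : ℕ → Subset n → ℤ
  yFactor j A = signedBinomial (∣ A ∣ ∸ rk A) j

  coeff-as-Σ : ∀ d j (ρ : Subset n → ℤ) → (∀ A → xFactor d A * yFactor j A ≡ ρ A) →
    coeff (multTutte MM) (+ r - + d) j ≡ Σ[ 𝒮 ] (λ A → μ A * ρ A)
  coeff-as-Σ d j ρ pointwise = trans (coeff-multTutte MM (+ r - + d) j) (Σ-cong 𝒮 (λ A → cong (μ A *_) (pointwise A)))

  data RankCase : Subset n → Set where
    empty  : RankCase ⊥
    rank₁  : ∀ {A} → rk A ≡ 1 → RankCase A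
    rank₂  : ∀ {A} → rk A ≡ 2 → RankCase A
    rank≥3 : ∀ {A} → 3 ≤ rk A → RankCase A

  rankCase : ∀ A → RankCase A
  rankCase A with rk A in rkA≡
  ... | zero              = subst RankCase (sym (rk≡0⇒≡⊥ rkA≡)) empty
  ... | suc zero          = rank₁ rkA≡
  ... | suc (suc zero)    = rank₂ rkA≡
  ... | suc (suc (suc _)) = rank≥3 (subst (3 ≤_) (sym rkA≡) (s≤s (s≤s (s≤s z≤n))))

  σ : Subset n → ℤ
  σ A = -1ℤ ^ ∣ A ∣

  rank≤size : ∀ {A s} → rk A ≡ s → s ≤ ∣ A ∣
  rank≤size {A} refl = rk-card A

  xFactor-diag : ∀ {d A} → rk A ≡ d → xFactor d A ≡ 1ℤ
  xFactor-diag {A = A} refl = signedBinomialℤ-diag (rk≤r A)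

  xFactor-pred : ∀ {s A} → rk A ≡ s → xFactor (suc s) A ≡ + s - + r
  xFactor-pred {A = A} refl = signedBinomialℤ-pred (rk≤r A)

  xFactor-vanish : ∀ {d} A → d < rk A → xFactor d A ≡ 0ℤ
  xFactor-vanish A d<rkA = signedBinomialℤ-vanish (rk≤r A) d<rkA

  xFactor-⊥ : ∀ d → xFactor d ⊥ ≡ signedBinomialℤ r (+ r - + d)
  xFactor-⊥ d = cong (λ s → signedBinomialℤ (r ∸ s) (+ r - + d)) rk⊥

  yFactor-⊥ : ∀ j → yFactor j ⊥ ≡ signedBinomial 0 j
  yFactor-⊥ j = cong₂ (λ a s → signedBinomial (a ∸ s) j) (∣⊥∣≡0 n) rk⊥

  yFactor-rank : ∀ {s A} j → rk A ≡ s → yFactor j A ≡ signedBinomial (∣ A ∣ ∸ s) j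
  yFactor-rank j refl = refl

  yFactor₀-rank₁ : ∀ {A} → rk A ≡ 1 → yFactor 0 A ≡ - σ A
  yFactor₀-rank₁ {A} rk≡1 = trans (yFactor-rank 0 rk≡1) (trans (signedBinomial-zero (∣ A ∣ ∸ 1)) (-1^[m∸1] (rank≤size rk≡1)))

  yFactor₁-rank₁ : ∀ {A} → rk A ≡ 1 → yFactor 1 A ≡ - (- σ A * + (∣ A ∣ ∸ 1))
  yFactor₁-rank₁ {A} rk≡1 = trans (yFactor-rank 1 rk≡1) (trans (signedBinomial-one (∣ A ∣ ∸ 1))
    (cong (λ s → - (s * + (∣ A ∣ ∸ 1))) (-1^[m∸1] (rank≤size rk≡1))))

  yFactor₂-rank₁ : ∀ {A} → rk A ≡ 1 → yFactor 2 A ≡ - σ A * + ((∣ A ∣ ∸ 1) C 2)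
  yFactor₂-rank₁ {A} rk≡1 = trans (yFactor-rank 2 rk≡1) (trans (signedBinomial-two (∣ A ∣ ∸ 1))
    (cong (_* + ((∣ A ∣ ∸ 1) C 2)) (-1^[m∸1] (rank≤size rk≡1))))

  yFactor₀-rank₂ : ∀ {A} → rk A ≡ 2 → yFactor 0 A ≡ σ A
  yFactor₀-rank₂ {A} rk≡2 = trans (yFactor-rank 0 rk≡2) (trans (signedBinomial-zero (∣ A ∣ ∸ 2)) (-1^[m∸2] (rank≤size rk≡2)))

  yFactor₁-rank₂ : ∀ {A} → rk A ≡ 2 → yFactor 1 A ≡ - (σ A * + (∣ A ∣ ∸ 2))
  yFactor₁-rank₂ {A} rk≡2 = trans (yFactor-rank 1 rk≡2) (trans (signedBinomial-one (∣ A ∣ ∸ 2))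
    (cong (λ s → - (s * + (∣ A ∣ ∸ 2))) (-1^[m∸2] (rank≤size rk≡2))))

  yFactor₂-rank₂ : ∀ {A} → rk A ≡ 2 → yFactor 2 A ≡ σ A * + ((∣ A ∣ ∸ 2) C 2)
  yFactor₂-rank₂ {A} rk≡2 = trans (yFactor-rank 2 rk≡2) (trans (signedBinomial-two (∣ A ∣ ∸ 2))
    (cong (_* + ((∣ A ∣ ∸ 2) C 2)) (-1^[m∸2] (rank≤size rk≡2))))

  -σ : ∀ A → -1ℤ ^ (∣ A ∣ ℕ.+ 1) ≡ - σ A
  -σ A = -1^[k+1] ∣ A ∣

  𝟙[⊥≟⊥] : 𝟙 (⊥ {n} ≟ˢ ⊥) ≡ 1ℤ
  𝟙[⊥≟⊥] = 𝟙-yes (⊥ {n} ≟ˢ ⊥) refl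

  𝟙[A≟⊥]≡0 : ∀ {A} → 0 < rk A → 𝟙 (A ≟ˢ ⊥) ≡ 0ℤ
  𝟙[A≟⊥]≡0 {A} 0<rk = 𝟙-no (A ≟ˢ ⊥) (λ A≡⊥ → ℕ.<⇒≱ 0<rk (ℕ.≤-reflexive (trans (cong rk A≡⊥) rk⊥)))

  𝟙≤?-⊥ : ∀ k → 𝟙 (suc k ℕ.≤? ∣ ⊥ {n} ∣) ≡ 0ℤ
  𝟙≤?-⊥ k = 𝟙-no (suc k ℕ.≤? ∣ ⊥ {n} ∣) (λ 1+k≤0 → ℕ.<⇒≱ (s≤s z≤n) (ℕ.≤-trans 1+k≤0 (ℕ.≤-reflexive (∣⊥∣≡0 n))))

  coefficient₁ : coeff (multTutte MM) (+ r) 0 ≡ + m ⊥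
  coefficient₁ = begin
    coeff (multTutte MM) (+ r) 0     ≡⟨ cong (λ i → coeff (multTutte MM) i 0) (sym (ℤ.+-identityʳ (+ r))) ⟩
    coeff (multTutte MM) (+ r - + 0) 0 ≡⟨ coeff-as-Σ 0 0 (λ A → 𝟙 (A ≟ˢ ⊥) * 1ℤ) (λ A → pointwise A (rankCase A)) ⟩
    Σ[ 𝒮 ] (λ A → μ A * (𝟙 (A ≟ˢ ⊥) * 1ℤ)) ≡⟨ sym (μ⊥-as-Σ 1ℤ) ⟩
    1ℤ * μ ⊥                          ≡⟨ ℤ.*-identityˡ (μ ⊥) ⟩
    + m ⊥                             ∎
    where
    open ≡-Reasoning
    nonempty : ∀ {A y} → 0 < rk A → xFactor 0 A * y ≡ 𝟙 (A ≟ˢ ⊥) * 1ℤ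
    nonempty {A} 0<rk = trans (cong (_* _) (xFactor-vanish A 0<rk)) (sym (cong (_* 1ℤ) (𝟙[A≟⊥]≡0 0<rk)))
    pointwise : ∀ A → RankCase A → xFactor 0 A * yFactor 0 A ≡ 𝟙 (A ≟ˢ ⊥) * 1ℤ
    pointwise _ empty       = trans (cong₂ _*_ (xFactor-diag rk⊥) (yFactor-⊥ 0)) (cong (_* 1ℤ) (sym 𝟙[⊥≟⊥]))
    pointwise _ (rank₁ eq)  = nonempty (ℕ.≤-reflexive (sym eq))
    pointwise _ (rank₂ eq)  = nonempty (ℕ.≤-trans (s≤s z≤n) (ℕ.≤-reflexive (sym eq)))
    pointwise _ (rank≥3 le) = nonempty (ℕ.≤-trans (s≤s z≤n) le)

  -σ-⊥ : -1ℤ ^ (∣ ⊥ {n} ∣ ℕ.+ 1) ≡ -1ℤ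
  -σ-⊥ = cong (λ a → -1ℤ ^ (a ℕ.+ 1)) (∣⊥∣≡0 n)

  σ-⊥ : σ ⊥ ≡ 1ℤ
  σ-⊥ = cong (-1ℤ ^_) (∣⊥∣≡0 n)

  coefficient₂ : coeff (multTutte MM) (+ r - + 1) 0
    ≡ (+ pM matroid - + r) * + m ⊥ + Σ[ flats matroid 1 ] (λ F → Σ[ subsetsOf F ] (λ A → -1ℤ ^ (∣ A ∣ ℕ.+ 1) * + m A))
  coefficient₂ = begin
    coeff (multTutte MM) (+ r - + 1) 0
      ≡⟨ coeff-as-Σ 1 0 (λ A → i A + s A * N A) (λ A → pointwise A (rankCase A)) ⟩
    Σ[ 𝒮 ] (λ A → μ A * (i A + s A * N A))
      ≡⟨ sym (Σ-μ-collect i (λ A → s A * N A)) ⟩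
    Σ[ 𝒮 ] (λ A → μ A * i A) + Σ[ 𝒮 ] (λ A → μ A * (s A * N A))
      ≡⟨ sym (cong₂ _+_ (μ⊥-as-Σ K) (trans (Σ-weight-one (flats matroid 1) _) (Σ-flats-subsetsOf (flat? 1) one s))) ⟩
    K * + m ⊥ + Σ[ flats matroid 1 ] (λ F → Σ[ subsetsOf F ] (λ A → s A * + m A)) ∎
    where
    open ≡-Reasoning
    K : ℤ
    K = + pM matroid - + r
    i s N : Subset n → ℤ
    i A = 𝟙 (A ≟ˢ ⊥) * K
    s A = -1ℤ ^ (∣ A ∣ ℕ.+ 1)
    N = Σ⊇ (flat? 1) one
    -- The case lemmas take the values of the factors as equations; matching them with refl leaves a ring identity.
    at-⊥ : ∀ {x y i s N} p R → x ≡ + 0 - R → y ≡ 1ℤ → i ≡ 1ℤ * (p - R) → s ≡ -1ℤ → N ≡ p → x * y ≡ i + s * N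
    at-⊥ p R refl refl refl refl refl = solve (p ∷ R ∷ [])
    at-rank₁ : ∀ {x y i s N} σ → x ≡ 1ℤ → y ≡ - σ → i ≡ 0ℤ * K → s ≡ - σ → N ≡ 1ℤ → x * y ≡ i + s * N
    at-rank₁ σ refl refl refl refl refl = solve (σ ∷ [])
    at-rank>1 : ∀ {x i N} y s → x ≡ 0ℤ → i ≡ 0ℤ * K → N ≡ 0ℤ → x * y ≡ i + s * N
    at-rank>1 y s refl refl refl = solve (y ∷ s ∷ [])
    rank>1 : ∀ {A} → 1 < rk A → xFactor 1 A * yFactor 0 A ≡ i A + s A * N A
    rank>1 {A} 1<rk = at-rank>1 (yFactor 0 A) (s A) (xFactor-vanish A 1<rk)
      (cong (_* K) (𝟙[A≟⊥]≡0 (ℕ.<-trans (s≤s z≤n) 1<rk)))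
      (Σ⊇-flats-vanish 1 one A 1<rk)
    pointwise : ∀ A → RankCase A → xFactor 1 A * yFactor 0 A ≡ i A + s A * N A
    pointwise _ empty        = at-⊥ (+ pM matroid) (+ r) (xFactor-pred rk⊥) (yFactor-⊥ 0) (cong (_* K) 𝟙[⊥≟⊥]) -σ-⊥ #flats₁⊇⊥
    pointwise A (rank₁ rk≡1) = at-rank₁ (σ A) (xFactor-diag rk≡1) (yFactor₀-rank₁ rk≡1)
      (cong (_* K) (𝟙[A≟⊥]≡0 (ℕ.≤-reflexive (sym rk≡1))))
      (-σ A) (Σ⊇-closure 1 one A rk≡1)
    pointwise _ (rank₂ rk≡2)  = rank>1 (ℕ.≤-reflexive (sym rk≡2))
    pointwise _ (rank≥3 3≤rk) = rank>1 (ℕ.≤-trans (s≤s (s≤s z≤n)) 3≤rk)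

  coefficient₃ : coeff (multTutte MM) (+ r - + 2) 0
    ≡ constant₃ * + m ⊥
      + Σ[ flats matroid 1 ] (λ F → w₁ F * Σ[ subsetsOf F ] (λ A → -1ℤ ^ (∣ A ∣ ℕ.+ 1) * + m A))
      + Σ[ flats matroid 2 ] (λ F → Σ[ subsetsOf F ] (λ A → -1ℤ ^ ∣ A ∣ * + m A))
  coefficient₃ = begin
    coeff (multTutte MM) (+ r - + 2) 0
      ≡⟨ coeff-as-Σ 2 0 (λ A → i A + s A * N₁ A + σ A * N₂ A) (λ A → pointwise A (rankCase A)) ⟩
    Σ[ 𝒮 ] (λ A → μ A * (i A + s A * N₁ A + σ A * N₂ A))
      ≡⟨ sym (trans (cong (_+ Σ[ 𝒮 ] (λ A → μ A * (σ A * N₂ A))) (Σ-μ-collect i (λ A → s A * N₁ A)))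
                   (Σ-μ-collect (λ A → i A + s A * N₁ A) (λ A → σ A * N₂ A))) ⟩
    Σ[ 𝒮 ] (λ A → μ A * i A) + Σ[ 𝒮 ] (λ A → μ A * (s A * N₁ A)) + Σ[ 𝒮 ] (λ A → μ A * (σ A * N₂ A))
      ≡⟨ sym (cong₂ _+_ (cong₂ _+_ (μ⊥-as-Σ constant₃) (Σ-flats-subsetsOf (flat? 1) w₁ s))
                        (trans (Σ-weight-one (flats matroid 2) _) (Σ-flats-subsetsOf (flat? 2) one σ))) ⟩
    constant₃ * + m ⊥ + Σ[ flats matroid 1 ] (λ F → w₁ F * Σ[ subsetsOf F ] (λ A → s A * + m A))
      + Σ[ flats matroid 2 ] (λ F → Σ[ subsetsOf F ] (λ A → σ A * + m A)) ∎
    where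
    open ≡-Reasoning
    i s N₁ N₂ : Subset n → ℤ
    i A = 𝟙 (A ≟ˢ ⊥) * constant₃
    s A = -1ℤ ^ (∣ A ∣ ℕ.+ 1)
    N₁ = Σ⊇ (flat? 1) w₁
    N₂ = Σ⊇ (flat? 2) one
    at-⊥ : ∀ {x y i K s σ} c a b → x ≡ c → y ≡ 1ℤ → i ≡ 1ℤ * K → K ≡ c + a - b → s ≡ -1ℤ → σ ≡ 1ℤ →
      x * y ≡ i + s * a + σ * b
    at-⊥ c a b refl refl refl refl refl refl = solve (c ∷ a ∷ b ∷ [])
    at-rank₁ : ∀ {x y i s N₁ N₂} σ p R → x ≡ + 1 - R → y ≡ - σ → i ≡ 0ℤ * constant₃ → s ≡ - σ →
      N₁ ≡ p - R + + 1 → N₂ ≡ p → x * y ≡ i + s * N₁ + σ * N₂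
    at-rank₁ σ p R refl refl refl refl refl refl = solve (σ ∷ p ∷ R ∷ [])
    at-rank₂ : ∀ {x y i N₁ N₂} s σ → x ≡ 1ℤ → y ≡ σ → i ≡ 0ℤ * constant₃ → N₁ ≡ 0ℤ → N₂ ≡ 1ℤ →
      x * y ≡ i + s * N₁ + σ * N₂
    at-rank₂ s σ refl refl refl refl refl = solve (s ∷ σ ∷ [])
    at-rank≥3 : ∀ {x i N₁ N₂} y s σ → x ≡ 0ℤ → i ≡ 0ℤ * constant₃ → N₁ ≡ 0ℤ → N₂ ≡ 0ℤ →
      x * y ≡ i + s * N₁ + σ * N₂
    at-rank≥3 y s σ refl refl refl refl = solve (y ∷ s ∷ σ ∷ [])
    pointwise : ∀ A → RankCase A → xFactor 2 A * yFactor 0 A ≡ i A + s A * N₁ A + σ A * N₂ A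
    pointwise _ empty = at-⊥ (+ (r C 2)) (N₁ ⊥) (N₂ ⊥) (trans (xFactor-⊥ 2) (signedBinomialℤ-C2 r)) (yFactor-⊥ 0)
      (cong (_* constant₃) 𝟙[⊥≟⊥]) constant₃≡ -σ-⊥ σ-⊥
    pointwise A (rank₁ rk≡1) = at-rank₁ (σ A) (+ pContr matroid (closure A)) (+ r) (xFactor-pred rk≡1) (yFactor₀-rank₁ rk≡1)
      (cong (_* constant₃) (𝟙[A≟⊥]≡0 (ℕ.≤-reflexive (sym rk≡1)))) (-σ A) (Σ⊇-closure 1 w₁ A rk≡1) (#flats₂⊇-rank1 A rk≡1)
    pointwise A (rank₂ rk≡2) = at-rank₂ (s A) (σ A) (xFactor-diag rk≡2) (yFactor₀-rank₂ rk≡2)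
      (cong (_* constant₃) (𝟙[A≟⊥]≡0 (ℕ.≤-trans (s≤s z≤n) 1<rk))) (Σ⊇-flats-vanish 1 w₁ A 1<rk) (Σ⊇-closure 2 one A rk≡2)
      where
      1<rk : 1 < rk A
      1<rk = ℕ.≤-reflexive (sym rk≡2)
    pointwise A (rank≥3 3≤rk) = at-rank≥3 (yFactor 0 A) (s A) (σ A) (xFactor-vanish A 3≤rk)
      (cong (_* constant₃) (𝟙[A≟⊥]≡0 (ℕ.≤-trans (s≤s z≤n) 3≤rk))) (Σ⊇-flats-vanish 1 w₁ A (ℕ.≤-trans (s≤s (s≤s z≤n)) 3≤rk))
      (Σ⊇-flats-vanish 2 one A 3≤rk)

  yFactor-vanish : ∀ {A} j → ∣ A ∣ < rk A ℕ.+ suc j → yFactor (suc j) A ≡ 0ℤ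
  yFactor-vanish {A} j small = signedBinomial-vanish (ℕ.m<n+o⇒m∸n<o ∣ A ∣ (rk A) small)

  yFactor-⊥-vanish : ∀ j → yFactor (suc j) ⊥ ≡ 0ℤ
  yFactor-⊥-vanish j =
    yFactor-vanish j (subst (_< rk ⊥ ℕ.+ suc j) (sym (∣⊥∣≡0 n)) (ℕ.≤-trans (s≤s z≤n) (ℕ.m≤n+m (suc j) (rk ⊥))))

  size<rank+ : ∀ {A s k} → rk A ≡ s → ¬ (s ℕ.+ k ≤ ∣ A ∣) → ∣ A ∣ < rk A ℕ.+ k
  size<rank+ refl small = ℕ.≰⇒> small

  guard-off₁ : ∀ {y I} x t N → y ≡ 0ℤ → I ≡ 0ℤ → x * y ≡ t * (I * N)
  guard-off₁ x t N refl refl = solve (x ∷ t ∷ N ∷ [])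

  guard-off₂ : ∀ {y I} x t N u N′ → y ≡ 0ℤ → I ≡ 0ℤ → x * y ≡ t * (I * N) + u * (I * N′)
  guard-off₂ x t N u N′ refl refl = solve (x ∷ t ∷ N ∷ u ∷ N′ ∷ [])

  beyond-rank₁ : ∀ {x N} y t I → x ≡ 0ℤ → N ≡ 0ℤ → x * y ≡ t * (I * N)
  beyond-rank₁ y t I refl refl = solve (y ∷ t ∷ I ∷ [])

  beyond-rank₂ : ∀ {x N N′} y t I u → x ≡ 0ℤ → N ≡ 0ℤ → N′ ≡ 0ℤ → x * y ≡ t * (I * N) + u * (I * N′)
  beyond-rank₂ y t I u refl refl refl = solve (y ∷ t ∷ I ∷ u ∷ [])

  coefficient₄ : coeff (multTutte MM) (+ r - + 1) 1
    ≡ Σ[ cyclicFlats matroid 1 ] (λ F → Σ[ subsetsOf≥ 2 F ] (λ A → -1ℤ ^ ∣ A ∣ * + (∣ A ∣ ∸ 1) * + m A))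
  coefficient₄ = begin
    coeff (multTutte MM) (+ r - + 1) 1
      ≡⟨ coeff-as-Σ 1 1 (λ A → t A * (I A * N A)) (λ A → pointwise A (rankCase A)) ⟩
    Σ[ 𝒮 ] (λ A → μ A * (t A * (I A * N A)))
      ≡⟨ sym (trans (Σ-weight-one (cyclicFlats matroid 1) _) (Σ-flats-subsetsOf≥ (cyclicFlat? 1) 2 one t)) ⟩
    Σ[ cyclicFlats matroid 1 ] (λ F → Σ[ subsetsOf≥ 2 F ] (λ A → t A * + m A)) ∎
    where
    open ≡-Reasoning
    t I N : Subset n → ℤ
    t A = σ A * + (∣ A ∣ ∸ 1)
    I A = 𝟙 (2 ℕ.≤? ∣ A ∣)
    N = Σ⊇ (cyclicFlat? 1) one
    at-rank₁ : ∀ {x y I N} σ X → x ≡ 1ℤ → y ≡ - (- σ * X) → I ≡ 1ℤ → N ≡ 1ℤ → x * y ≡ σ * X * (I * N)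
    at-rank₁ σ X refl refl refl refl = solve (σ ∷ X ∷ [])
    rank₁-case : ∀ {A} → rk A ≡ 1 → Dec (2 ≤ ∣ A ∣) → xFactor 1 A * yFactor 1 A ≡ t A * (I A * N A)
    rank₁-case {A} rk≡1 (yes 2≤∣A∣) = at-rank₁ (σ A) (+ (∣ A ∣ ∸ 1)) (xFactor-diag rk≡1) (yFactor₁-rank₁ rk≡1)
      (𝟙-yes (2 ℕ.≤? ∣ A ∣) 2≤∣A∣) (Σ⊇-cyclic-closure one A rk≡1 2≤∣A∣)
    rank₁-case {A} rk≡1 (no ∣A∣<2) = guard-off₁ (xFactor 1 A) (t A) (N A) (yFactor-vanish 0 (size<rank+ rk≡1 ∣A∣<2))
      (𝟙-no (2 ℕ.≤? ∣ A ∣) ∣A∣<2)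
    rank>1 : ∀ {A} → 1 < rk A → xFactor 1 A * yFactor 1 A ≡ t A * (I A * N A)
    rank>1 {A} 1<rk = beyond-rank₁ (yFactor 1 A) (t A) (I A) (xFactor-vanish A 1<rk) (Σ⊇-cyclicFlats-vanish one A 1<rk)
    pointwise : ∀ A → RankCase A → xFactor 1 A * yFactor 1 A ≡ t A * (I A * N A)
    pointwise _ empty         = guard-off₁ (xFactor 1 ⊥) (t ⊥) (N ⊥) (yFactor-⊥-vanish 0) (𝟙≤?-⊥ 1)
    pointwise A (rank₁ rk≡1)  = rank₁-case rk≡1 (2 ℕ.≤? ∣ A ∣)
    pointwise _ (rank₂ rk≡2)  = rank>1 (ℕ.≤-reflexive (sym rk≡2))
    pointwise _ (rank≥3 3≤rk) = rank>1 (ℕ.≤-trans (s≤s (s≤s z≤n)) 3≤rk)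

  coefficient₅ : coeff (multTutte MM) (+ r - + 2) 1
    ≡ Σ[ cyclicFlats matroid 1 ] (λ F → w₁ F * Σ[ subsetsOf≥ 2 F ] (λ A → -1ℤ ^ ∣ A ∣ * + (∣ A ∣ ∸ 1) * + m A))
      + Σ[ flats matroid 2 ] (λ F → Σ[ subsetsOf≥ 2 F ] (λ A → -1ℤ ^ (∣ A ∣ ℕ.+ 1) * + (∣ A ∣ ∸ rk A) * + m A))
  coefficient₅ = begin
    coeff (multTutte MM) (+ r - + 2) 1
      ≡⟨ coeff-as-Σ 2 1 (λ A → t A * (I A * N₁ A) + u A * (I A * N₂ A)) (λ A → pointwise A (rankCase A)) ⟩
    Σ[ 𝒮 ] (λ A → μ A * (t A * (I A * N₁ A) + u A * (I A * N₂ A)))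
      ≡⟨ sym (Σ-μ-collect (λ A → t A * (I A * N₁ A)) (λ A → u A * (I A * N₂ A))) ⟩
    Σ[ 𝒮 ] (λ A → μ A * (t A * (I A * N₁ A))) + Σ[ 𝒮 ] (λ A → μ A * (u A * (I A * N₂ A)))
      ≡⟨ sym (cong₂ _+_ (Σ-flats-subsetsOf≥ (cyclicFlat? 1) 2 w₁ t)
                        (trans (Σ-weight-one (flats matroid 2) _) (Σ-flats-subsetsOf≥ (flat? 2) 2 one u))) ⟩
    Σ[ cyclicFlats matroid 1 ] (λ F → w₁ F * Σ[ subsetsOf≥ 2 F ] (λ A → t A * + m A))
      + Σ[ flats matroid 2 ] (λ F → Σ[ subsetsOf≥ 2 F ] (λ A → u A * + m A)) ∎
    where
    open ≡-Reasoning
    t u I N₁ N₂ : Subset n → ℤ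
    t A = σ A * + (∣ A ∣ ∸ 1)
    u A = -1ℤ ^ (∣ A ∣ ℕ.+ 1) * + (∣ A ∣ ∸ rk A)
    I A = 𝟙 (2 ℕ.≤? ∣ A ∣)
    N₁ = Σ⊇ (cyclicFlat? 1) w₁
    N₂ = Σ⊇ (flat? 2) one
    u-rank : ∀ {A s} → rk A ≡ s → u A ≡ - σ A * + (∣ A ∣ ∸ s)
    u-rank {A} refl = cong (_* + (∣ A ∣ ∸ rk A)) (-σ A)
    at-rank₁ : ∀ {x y I N₁ N₂ u} σ X p R → x ≡ + 1 - R → y ≡ - (- σ * X) → I ≡ 1ℤ → N₁ ≡ p - R + + 1 → N₂ ≡ p →
      u ≡ - σ * X → x * y ≡ σ * X * (I * N₁) + u * (I * N₂)
    at-rank₁ σ X p R refl refl refl refl refl refl = solve (σ ∷ X ∷ p ∷ R ∷ [])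
    at-rank₂ : ∀ {x y I N₁ N₂ u} t σ Y → x ≡ 1ℤ → y ≡ - (σ * Y) → I ≡ 1ℤ → N₁ ≡ 0ℤ → N₂ ≡ 1ℤ →
      u ≡ - σ * Y → x * y ≡ t * (I * N₁) + u * (I * N₂)
    at-rank₂ t σ Y refl refl refl refl refl refl = solve (t ∷ σ ∷ Y ∷ [])
    rank₁-case : ∀ {A} → rk A ≡ 1 → Dec (2 ≤ ∣ A ∣) → xFactor 2 A * yFactor 1 A ≡ t A * (I A * N₁ A) + u A * (I A * N₂ A)
    rank₁-case {A} rk≡1 (yes 2≤∣A∣) = at-rank₁ (σ A) (+ (∣ A ∣ ∸ 1)) (+ pContr matroid (closure A)) (+ r)
      (xFactor-pred rk≡1) (yFactor₁-rank₁ rk≡1) (𝟙-yes (2 ℕ.≤? ∣ A ∣) 2≤∣A∣) (Σ⊇-cyclic-closure w₁ A rk≡1 2≤∣A∣)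
      (#flats₂⊇-rank1 A rk≡1) (u-rank rk≡1)
    rank₁-case {A} rk≡1 (no ∣A∣<2) = guard-off₂ (xFactor 2 A) (t A) (N₁ A) (u A) (N₂ A)
      (yFactor-vanish 0 (size<rank+ rk≡1 ∣A∣<2)) (𝟙-no (2 ℕ.≤? ∣ A ∣) ∣A∣<2)
    pointwise : ∀ A → RankCase A → xFactor 2 A * yFactor 1 A ≡ t A * (I A * N₁ A) + u A * (I A * N₂ A)
    pointwise _ empty = guard-off₂ (xFactor 2 ⊥) (t ⊥) (N₁ ⊥) (u ⊥) (N₂ ⊥) (yFactor-⊥-vanish 0) (𝟙≤?-⊥ 1)
    pointwise A (rank₁ rk≡1) = rank₁-case rk≡1 (2 ℕ.≤? ∣ A ∣)
    pointwise A (rank₂ rk≡2) = at-rank₂ (t A) (σ A) (+ (∣ A ∣ ∸ 2)) (xFactor-diag rk≡2) (yFactor₁-rank₂ rk≡2)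
      (𝟙-yes (2 ℕ.≤? ∣ A ∣) (rank≤size rk≡2)) (Σ⊇-cyclicFlats-vanish w₁ A (ℕ.≤-reflexive (sym rk≡2)))
      (Σ⊇-closure 2 one A rk≡2) (u-rank rk≡2)
    pointwise A (rank≥3 3≤rk) = beyond-rank₂ (yFactor 1 A) (t A) (I A) (u A) (xFactor-vanish A 3≤rk)
      (Σ⊇-cyclicFlats-vanish w₁ A (ℕ.≤-trans (s≤s (s≤s z≤n)) 3≤rk)) (Σ⊇-flats-vanish 2 one A 3≤rk)

  coefficient₆ : coeff (multTutte MM) (+ r - + 2) 2
    ≡ Σ[ cyclicFlats matroid 1 ] (λ F → w₁ F * Σ[ subsetsOf≥ 3 F ] (λ A → -1ℤ ^ (∣ A ∣ ℕ.+ 1) * + ((∣ A ∣ ∸ 1) C 2) * + m A))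
      + Σ[ flats matroid 2 ] (λ F → Σ[ subsetsOf≥ 3 F ] (λ A → -1ℤ ^ ∣ A ∣ * + ((∣ A ∣ ∸ rk A) C 2) * + m A))
  coefficient₆ = begin
    coeff (multTutte MM) (+ r - + 2) 2
      ≡⟨ coeff-as-Σ 2 2 (λ A → t A * (I A * N₁ A) + u A * (I A * N₂ A)) (λ A → pointwise A (rankCase A)) ⟩
    Σ[ 𝒮 ] (λ A → μ A * (t A * (I A * N₁ A) + u A * (I A * N₂ A)))
      ≡⟨ sym (Σ-μ-collect (λ A → t A * (I A * N₁ A)) (λ A → u A * (I A * N₂ A))) ⟩
    Σ[ 𝒮 ] (λ A → μ A * (t A * (I A * N₁ A))) + Σ[ 𝒮 ] (λ A → μ A * (u A * (I A * N₂ A)))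
      ≡⟨ sym (cong₂ _+_ (Σ-flats-subsetsOf≥ (cyclicFlat? 1) 3 w₁ t)
                        (trans (Σ-weight-one (flats matroid 2) _) (Σ-flats-subsetsOf≥ (flat? 2) 3 one u))) ⟩
    Σ[ cyclicFlats matroid 1 ] (λ F → w₁ F * Σ[ subsetsOf≥ 3 F ] (λ A → t A * + m A))
      + Σ[ flats matroid 2 ] (λ F → Σ[ subsetsOf≥ 3 F ] (λ A → u A * + m A)) ∎
    where
    open ≡-Reasoning
    t u I N₁ N₂ : Subset n → ℤ
    t A = -1ℤ ^ (∣ A ∣ ℕ.+ 1) * + ((∣ A ∣ ∸ 1) C 2)
    u A = σ A * + ((∣ A ∣ ∸ rk A) C 2)
    I A = 𝟙 (3 ℕ.≤? ∣ A ∣)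
    N₁ = Σ⊇ (cyclicFlat? 1) w₁
    N₂ = Σ⊇ (flat? 2) one
    u-rank : ∀ {A s} → rk A ≡ s → u A ≡ σ A * + ((∣ A ∣ ∸ s) C 2)
    u-rank refl = refl
    at-rank₁ : ∀ {x y I N₁ N₂ t u} σ Q p R → x ≡ + 1 - R → y ≡ - σ * Q → I ≡ 1ℤ → N₁ ≡ p - R + + 1 → N₂ ≡ p →
      t ≡ - σ * Q → u ≡ σ * Q → x * y ≡ t * (I * N₁) + u * (I * N₂)
    at-rank₁ σ Q p R refl refl refl refl refl refl refl = solve (σ ∷ Q ∷ p ∷ R ∷ [])
    at-rank₂ : ∀ {x y I N₁ N₂ u} t σ Q → x ≡ 1ℤ → y ≡ σ * Q → I ≡ 1ℤ → N₁ ≡ 0ℤ → N₂ ≡ 1ℤ →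
      u ≡ σ * Q → x * y ≡ t * (I * N₁) + u * (I * N₂)
    at-rank₂ t σ Q refl refl refl refl refl refl = solve (t ∷ σ ∷ Q ∷ [])
    small : ∀ {A s} → rk A ≡ s → ¬ (3 ≤ ∣ A ∣) → 3 ≤ s ℕ.+ 2 →
      xFactor 2 A * yFactor 2 A ≡ t A * (I A * N₁ A) + u A * (I A * N₂ A)
    small {A} rk≡s ∣A∣<3 s+2≥3 = guard-off₂ (xFactor 2 A) (t A) (N₁ A) (u A) (N₂ A)
      (yFactor-vanish 1 (ℕ.<-≤-trans (ℕ.≰⇒> ∣A∣<3) (ℕ.≤-trans s+2≥3 (ℕ.≤-reflexive (cong (ℕ._+ 2) (sym rk≡s))))))
      (𝟙-no (3 ℕ.≤? ∣ A ∣) ∣A∣<3)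
    rank₁-case : ∀ {A} → rk A ≡ 1 → Dec (3 ≤ ∣ A ∣) → xFactor 2 A * yFactor 2 A ≡ t A * (I A * N₁ A) + u A * (I A * N₂ A)
    rank₁-case {A} rk≡1 (yes 3≤∣A∣) = at-rank₁ (σ A) (+ ((∣ A ∣ ∸ 1) C 2)) (+ pContr matroid (closure A)) (+ r)
      (xFactor-pred rk≡1) (yFactor₂-rank₁ rk≡1) (𝟙-yes (3 ℕ.≤? ∣ A ∣) 3≤∣A∣)
      (Σ⊇-cyclic-closure w₁ A rk≡1 (ℕ.≤-trans (ℕ.n≤1+n 2) 3≤∣A∣)) (#flats₂⊇-rank1 A rk≡1)
      (cong (_* + ((∣ A ∣ ∸ 1) C 2)) (-σ A)) (u-rank rk≡1)
    rank₁-case rk≡1 (no ∣A∣<3) = small rk≡1 ∣A∣<3 ℕ.≤-refl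
    rank₂-case : ∀ {A} → rk A ≡ 2 → Dec (3 ≤ ∣ A ∣) → xFactor 2 A * yFactor 2 A ≡ t A * (I A * N₁ A) + u A * (I A * N₂ A)
    rank₂-case {A} rk≡2 (yes 3≤∣A∣) = at-rank₂ (t A) (σ A) (+ ((∣ A ∣ ∸ 2) C 2)) (xFactor-diag rk≡2) (yFactor₂-rank₂ rk≡2)
      (𝟙-yes (3 ℕ.≤? ∣ A ∣) 3≤∣A∣) (Σ⊇-cyclicFlats-vanish w₁ A (ℕ.≤-reflexive (sym rk≡2))) (Σ⊇-closure 2 one A rk≡2)
      (u-rank rk≡2)
    rank₂-case rk≡2 (no ∣A∣<3) = small rk≡2 ∣A∣<3 (ℕ.n≤1+n 3)
    pointwise : ∀ A → RankCase A → xFactor 2 A * yFactor 2 A ≡ t A * (I A * N₁ A) + u A * (I A * N₂ A)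
    pointwise _ empty = guard-off₂ (xFactor 2 ⊥) (t ⊥) (N₁ ⊥) (u ⊥) (N₂ ⊥) (yFactor-⊥-vanish 1) (𝟙≤?-⊥ 2)
    pointwise A (rank₁ rk≡1) = rank₁-case rk≡1 (3 ℕ.≤? ∣ A ∣)
    pointwise A (rank₂ rk≡2) = rank₂-case rk≡2 (3 ℕ.≤? ∣ A ∣)
    pointwise A (rank≥3 3≤rk) = beyond-rank₂ (yFactor 2 A) (t A) (I A) (u A) (xFactor-vanish A 3≤rk)
      (Σ⊇-cyclicFlats-vanish w₁ A (ℕ.≤-trans (s≤s (s≤s z≤n)) 3≤rk)) (Σ⊇-flats-vanish 2 one A 3≤rk)

theorem3p3 : ∀ {n : ℕ} (MM : MultMatroid n) → Loopless (MultMatroid.matroid MM) →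
  let open MultMatroid MM
      M = matroid
      r = rkM M
      b = coeff (multTutte MM)
  in (b (+ r) 0 ≡ + m ⊥)
   × (b (+ r - + 1) 0 ≡ (+ pM M - + r) * + m ⊥
        + Σ[ flats M 1 ] (λ F → Σ[ subsetsOf F ] (λ A → (-1ℤ ^ (∣ A ∣ Data.Nat.+ 1)) * + m A)))
   × (b (+ r - + 2) 0 ≡ (+ (r C 2) - (+ r - + 1) * + pM M + Σ[ flats M 2 ] (λ F → + pRestr M F - + 1)) * + m ⊥
        + Σ[ flats M 1 ] (λ F → (+ pContr M F - + r + + 1)
              * Σ[ subsetsOf F ] (λ A → (-1ℤ ^ (∣ A ∣ Data.Nat.+ 1)) * + m A))
        + Σ[ flats M 2 ] (λ F → Σ[ subsetsOf F ] (λ A → (-1ℤ ^ ∣ A ∣) * + m A)))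
   × (b (+ r - + 1) 1 ≡ Σ[ cyclicFlats M 1 ] (λ F → Σ[ subsetsOf≥ 2 F ] (λ A →
        (-1ℤ ^ ∣ A ∣) * + (∣ A ∣ ∸ 1) * + m A)))
   × (b (+ r - + 2) 1 ≡ Σ[ cyclicFlats M 1 ] (λ F → (+ pContr M F - + r + + 1)
              * Σ[ subsetsOf≥ 2 F ] (λ A → (-1ℤ ^ ∣ A ∣) * + (∣ A ∣ ∸ 1) * + m A))
        + Σ[ flats M 2 ] (λ F → Σ[ subsetsOf≥ 2 F ] (λ A →
              (-1ℤ ^ (∣ A ∣ Data.Nat.+ 1)) * + (∣ A ∣ ∸ rk A) * + m A)))
   × (b (+ r - + 2) 2 ≡ Σ[ cyclicFlats M 1 ] (λ F → (+ pContr M F - + r + + 1)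
              * Σ[ subsetsOf≥ 3 F ] (λ A → (-1ℤ ^ (∣ A ∣ Data.Nat.+ 1)) * + ((∣ A ∣ ∸ 1) C 2) * + m A))
        + Σ[ flats M 2 ] (λ F → Σ[ subsetsOf≥ 3 F ] (λ A →
              (-1ℤ ^ ∣ A ∣) * + ((∣ A ∣ ∸ rk A) C 2) * + m A)))
theorem3p3 MM loopless =
  coefficient₁ , coefficient₂ , coefficient₃ , coefficient₄ , coefficient₅ , coefficient₆
  where open Coefficients MM loopless
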